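{- Let $G=(V,E)$ be a simple undirected graph on $n\geq 4$ vertices with no isolated vertices. Let $r$ be the number of vertices of degree $1$ and $p$ the number of vertices of degree $n-1$, and write $d(v)$ for the degree of a vertex $v$. Then $G$ is an equimatchable split graph if and only if at least one of the following holds: (i) $p=n$; (ii) $r=n-1$ and $p=1$; (iii) $p=1$, $r\geq 2$, $n-r$ is even, and every vertex has degree $1$, $n-r-1$ or $n-1$; (iv) $p=0$, $r\geq 2$, $n-r$ is even, and there are two vertices $x,y$ with $xy\notin E$, $d(x)=n-2$, $d(y)=n-r-2$, such that every vertex in $V\setminus\{x,y\}$ has degree $1$ or $n-r-1$; (v) $n$ is odd and there are two vertices $x,y$ with $d(x)+d(y)=p+n-2$ such that every vertex in $V\setminus\{x,y\}$ has degree $n-1$ or $n-2$.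
   Context: A matching is a set of pairwise vertex-disjoint edges; it is maximal if it is not properly contained in another matching. A graph is equimatchable if all its maximal matchings have the same number of edges. A graph is split if its vertex set can be partitioned into a clique and an independent set. A vertex is isolated if it has degree $0$. -}

module Defs where

open import Data.Nat using (ℕ; _≟_)
open import Data.Bool using (Bool; true; false)
open import Data.Bool.Properties using () renaming (_≟_ to _≟ᵇ_)
open import Data.Fin using (Fin)
open import Data.List using (List; []; _∷_; length; filter; concatMap; allFin)
open import Data.List.Relation.Unary.All using (All)
open import Data.List.Relation.Unary.Any using (Any)
open import Data.List.Relation.Unary.Unique.Propositional using (Unique)
open import Data.Product using (_×_; _,_; Σ)
open import Data.Sum using (_⊎_)
open import Relation.Binary.PropositionalEquality using (_≡_; _≢_)
open import Relation.Nullary using (¬_)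

record Graph (n : ℕ) : Set where
  field
    adj   : Fin n → Fin n → Bool
    sym   : ∀ u v → adj u v ≡ adj v u
    irrefl : ∀ v → adj v v ≡ false

module _ {n : ℕ} (G : Graph n) where
  open Graph G

  Adj : Fin n → Fin n → Set
  Adj u v = adj u v ≡ true

  deg : Fin n → ℕ
  deg v = length (filter (λ w → adj v w ≟ᵇ true) (allFin n))

  numDeg : ℕ → ℕ
  numDeg k = length (filter (λ v → deg v ≟ k) (allFin n))

  Edge : Set
  Edge = Fin n × Fin n

  SameEdge : Edge → Edge → Set
  SameEdge (a , b) (c , d) = (a ≡ c × b ≡ d) ⊎ (a ≡ d × b ≡ c)

  _∈E_ : Edge → List Edge → Set
  e ∈E M = Any (SameEdge e) M

  _⊆E_ : List Edge → List Edge → Set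
  M ⊆E M' = ∀ e → e ∈E M → e ∈E M'

  endpoints : List Edge → List (Fin n)
  endpoints = concatMap (λ { (u , v) → u ∷ v ∷ [] })

  IsMatching : List Edge → Set
  IsMatching M = All (λ { (u , v) → Adj u v }) M × Unique (endpoints M)

  IsMaximalMatching : List Edge → Set
  IsMaximalMatching M = IsMatching M × (∀ M' → IsMatching M' → M ⊆E M' → M' ⊆E M)

  Equimatchable : Set
  Equimatchable = ∀ M M' → IsMaximalMatching M → IsMaximalMatching M' → length M ≡ length M'

  IsSplit : Set
  IsSplit = Σ (Fin n → Bool) λ inC →
    (∀ u v → u ≢ v → inC u ≡ true → inC v ≡ true → Adj u v) ×
    (∀ u v → inC u ≡ false → inC v ≡ false → ¬ Adj u v)

  NoIsolated : Set
  NoIsolated = ∀ v → ¬ deg v ≡ 0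

module Submission where

open import Defs
open import Data.Nat using (ℕ; _+_; _∸_; _≤_; suc; s≤s; z≤n)
open import Data.Nat.Divisibility using (_∣_)
open import Data.Fin using (Fin)
open import Data.Product using (_×_; Σ; _,_)
open import Data.Sum using (_⊎_)
open import Relation.Binary.PropositionalEquality using (_≡_; _≢_)
open import Relation.Nullary using (¬_)
open import Function.Bundles using (_⇔_; mk⇔)
open import Data.Bool using (Bool)
open import Data.Parity.Base using (0ℙ; 1ℙ)

module Counting where

  open import Data.Nat
  open import Data.Nat.Properties
  open import Data.Nat.Divisibility using (_∣_; divides)
  open import Data.Bool using (Bool; true; false; _∧_; _∨_; not)
  open import Data.Bool.Properties using (∧-identityʳ)
  open import Data.Parity.Base using (_⁻¹)
  open import Data.Parity.Properties using (+-homo-+; *-homo-*; p+p≡0ℙ)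
  import Data.Parity.Properties as ℙ
  open import Data.Fin using (Fin; zero; suc)
  open import Data.Fin.Properties using () renaming (_≟_ to _≟F_; suc-injective to Fin-suc-injective)
  open import Data.List using (length; filter; tabulate; allFin)
  open import Data.Product using (Σ; _,_)
  open import Data.Sum using (_⊎_; inj₁; inj₂)
  open import Data.Empty using (⊥-elim)
  open import Function using (_∘_; id)
  open import Relation.Nullary using (yes; no; does)
  open import Relation.Unary using (Decidable; Pred)
  open import Relation.Binary.PropositionalEquality

  true≢false : true ≢ false
  true≢false ()

  ∧-true₁ : ∀ {a b} → a ∧ b ≡ true → a ≡ true
  ∧-true₁ {true} p = refl

  ∧-true₂ : ∀ {a b} → a ∧ b ≡ true → b ≡ true
  ∧-true₂ {true} p = p

  ∧-intro : ∀ {a b} → a ≡ true → b ≡ true → a ∧ b ≡ true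
  ∧-intro refl refl = refl

  not-true : ∀ {a} → not a ≡ true → a ≡ false
  not-true {false} p = refl

  not-false : ∀ {a} → a ≡ false → not a ≡ true
  not-false refl = refl

  bit : Bool → ℕ
  bit true = 1
  bit false = 0

  count : ∀ {n} → (Fin n → Bool) → ℕ
  count {zero} f = 0
  count {suc n} f = bit (f zero) + count (f ∘ suc)

  length-filter-tabulate : ∀ {a p} {A : Set a} {P : Pred A p} (P? : Decidable P) {n} (f : Fin n → A) →
    length (filter P? (tabulate f)) ≡ count (λ i → does (P? (f i)))
  length-filter-tabulate P? {zero} f = refl
  length-filter-tabulate P? {suc n} f with does (P? (f zero))
  ... | true = cong suc (length-filter-tabulate P? (f ∘ suc))
  ... | false = length-filter-tabulate P? (f ∘ suc)

  length-filter-allFin : ∀ {p} {n} {P : Pred (Fin n) p} (P? : Decidable P) →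
    length (filter P? (allFin n)) ≡ count (λ i → does (P? i))
  length-filter-allFin P? = length-filter-tabulate P? id

  count-ext : ∀ {n} {f g : Fin n → Bool} → (∀ i → f i ≡ g i) → count f ≡ count g
  count-ext {zero} h = refl
  count-ext {suc n} h = cong₂ _+_ (cong bit (h zero)) (count-ext (h ∘ suc))

  count-mono : ∀ {n} (f g : Fin n → Bool) → (∀ i → f i ≡ true → g i ≡ true) → count f ≤ count g
  count-mono {zero} f g h = z≤n
  count-mono {suc n} f g h with f zero | g zero | h zero
  ... | true | true | _ = s≤s (count-mono (f ∘ suc) (g ∘ suc) (h ∘ suc))
  ... | true | false | hz = ⊥-elim (true≢false (sym (hz refl)))
  ... | false | true | _ = m≤n⇒m≤1+n (count-mono (f ∘ suc) (g ∘ suc) (h ∘ suc))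
  ... | false | false | _ = count-mono (f ∘ suc) (g ∘ suc) (h ∘ suc)

  count-all : ∀ {n} (f : Fin n → Bool) → (∀ i → f i ≡ true) → count f ≡ n
  count-all {zero} f h = refl
  count-all {suc n} f h rewrite h zero = cong suc (count-all (f ∘ suc) (h ∘ suc))

  count-none : ∀ {n} (f : Fin n → Bool) → (∀ i → f i ≡ false) → count f ≡ 0
  count-none {zero} f h = refl
  count-none {suc n} f h rewrite h zero = count-none (f ∘ suc) (h ∘ suc)

  count-witness : ∀ {n} (f : Fin n → Bool) → count f ≢ 0 → Σ (Fin n) λ i → f i ≡ true
  count-witness {zero} f h = ⊥-elim (h refl)
  count-witness {suc n} f h with f zero in eq
  ... | true = zero , eq
  ... | false = let (i , p) = count-witness (f ∘ suc) h in suc i , p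

  search : ∀ {n} (f : Fin n → Bool) → (Σ (Fin n) λ i → f i ≡ true) ⊎ (∀ i → f i ≡ false)
  search {zero} f = inj₂ (λ ())
  search {suc n} f with f zero in e
  ... | true = inj₁ (zero , e)
  ... | false with search (f ∘ suc)
  ... | inj₁ (i , p) = inj₁ (suc i , p)
  ... | inj₂ h = inj₂ (λ { zero → e ; (suc i) → h i })

  search2 : ∀ {n k} (f : Fin n → Fin k → Bool) →
    (Σ (Fin n) λ i → Σ (Fin k) λ j → f i j ≡ true) ⊎ (∀ i j → f i j ≡ false)
  search2 {zero} f = inj₂ (λ ())
  search2 {suc n} f with search (f zero)
  ... | inj₁ (j , p) = inj₁ (zero , j , p)
  ... | inj₂ h0 with search2 (λ i j → f (suc i) j)
  ... | inj₁ (i , j , p) = inj₁ (suc i , j , p)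
  ... | inj₂ h = inj₂ (λ { zero j → h0 j ; (suc i) j → h i j })

  count-split : ∀ {n} (f g : Fin n → Bool) →
    count f ≡ count (λ i → f i ∧ g i) + count (λ i → f i ∧ not (g i))
  count-split {zero} f g = refl
  count-split {suc n} f g with f zero | g zero
  ... | true | true = cong suc (count-split (f ∘ suc) (g ∘ suc))
  ... | true | false = trans (cong suc (count-split (f ∘ suc) (g ∘ suc))) (sym (+-suc _ _))
  ... | false | true = count-split (f ∘ suc) (g ∘ suc)
  ... | false | false = count-split (f ∘ suc) (g ∘ suc)

  count-complement : ∀ {n} (f : Fin n → Bool) → count f + count (not ∘ f) ≡ n
  count-complement f = trans (sym (count-split (λ _ → true) f)) (count-all (λ _ → true) (λ _ → refl))

  count-∨ : ∀ {n} (f g : Fin n → Bool) →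
    count (λ i → f i ∨ g i) + count (λ i → f i ∧ g i) ≡ count f + count g
  count-∨ {zero} f g = refl
  count-∨ {suc n} f g with f zero | g zero
  ... | true | true = cong suc (trans (+-suc _ _)
        (trans (cong suc (count-∨ (f ∘ suc) (g ∘ suc))) (sym (+-suc (count (f ∘ suc)) (count (g ∘ suc))))))
  ... | true | false = cong suc (count-∨ (f ∘ suc) (g ∘ suc))
  ... | false | true = trans (cong suc (count-∨ (f ∘ suc) (g ∘ suc))) (sym (+-suc (count (f ∘ suc)) (count (g ∘ suc))))
  ... | false | false = count-∨ (f ∘ suc) (g ∘ suc)

  count-∨-≤ : ∀ {n} (f g : Fin n → Bool) → count (λ i → f i ∨ g i) ≤ count f + count g
  count-∨-≤ f g = subst (count (λ i → f i ∨ g i) ≤_) (count-∨ f g) (m≤m+n _ _)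

  -- If f implies g and g is not larger than f, then g implies f: this is how
  -- a degree equal to its maximal possible value yields adjacencies.
  count-saturate : ∀ {n} (f g : Fin n → Bool) → (∀ i → f i ≡ true → g i ≡ true) → count g ≤ count f →
    ∀ i → g i ≡ true → f i ≡ true
  count-saturate {suc n} f g h le i gi with f zero in ef | g zero in eg
  ... | true | false = ⊥-elim (true≢false (trans (sym (h zero ef)) eg))
  ... | false | true = ⊥-elim (<⇒≱ (s≤s (count-mono (f ∘ suc) (g ∘ suc) (h ∘ suc))) le)
  count-saturate {suc n} f g h le zero gi | true | true = ef
  count-saturate {suc n} f g h le (suc i) gi | true | true =
    count-saturate (f ∘ suc) (g ∘ suc) (h ∘ suc) (≤-pred le) i gi
  count-saturate {suc n} f g h le zero gi | false | false = ⊥-elim (true≢false (trans (sym gi) eg))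
  count-saturate {suc n} f g h le (suc i) gi | false | false =
    count-saturate (f ∘ suc) (g ∘ suc) (h ∘ suc) le i gi

  eqb : ∀ {n} → Fin n → Fin n → Bool
  eqb i j = does (i ≟F j)

  eqb-refl : ∀ {n} (i : Fin n) → eqb i i ≡ true
  eqb-refl i with i ≟F i
  ... | yes _ = refl
  ... | no ¬p = ⊥-elim (¬p refl)

  eqb-≡ : ∀ {n} {i j : Fin n} → eqb i j ≡ true → i ≡ j
  eqb-≡ {i = i} {j} e with i ≟F j
  ... | yes p = p

  eqb-≢ : ∀ {n} {i j : Fin n} → i ≢ j → eqb i j ≡ false
  eqb-≢ {i = i} {j} ne with i ≟F j
  ... | yes p = ⊥-elim (ne p)
  ... | no _ = refl

  eqb-false : ∀ {n} {i j : Fin n} → eqb i j ≡ false → i ≢ j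
  eqb-false {i = i} {j} e p with i ≟F j
  ... | no q = q p

  count-pos : ∀ {n} (f : Fin n → Bool) i → f i ≡ true → 1 ≤ count f
  count-pos {suc n} f zero e rewrite e = s≤s z≤n
  count-pos {suc n} f (suc i) e = ≤-trans (count-pos (f ∘ suc) i e) (m≤n+m _ (bit (f zero)))

  count-atMostOne : ∀ {n} (f : Fin n → Bool) → (∀ i j → f i ≡ true → f j ≡ true → i ≡ j) → count f ≤ 1
  count-atMostOne {zero} f h = z≤n
  count-atMostOne {suc n} f h with f zero in e
  ... | true = ≤-reflexive (cong suc (count-none (f ∘ suc) restFalse))
    where restFalse : ∀ i → f (suc i) ≡ false
          restFalse i with f (suc i) in e2
          ... | false = refl
          ... | true with h zero (suc i) e e2
          ... | ()
  ... | false = count-atMostOne (f ∘ suc) λ i j p q → Fin-suc-injective (h (suc i) (suc j) p q)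

  count-single : ∀ {n} (f : Fin n → Bool) i → f i ≡ true → (∀ j → f j ≡ true → j ≡ i) → count f ≡ 1
  count-single f i e h = ≤-antisym (count-atMostOne f λ a b p q → trans (h a p) (sym (h b q))) (count-pos f i e)

  count-eqb : ∀ {n} (z : Fin n) → count (λ v → eqb v z) ≡ 1
  count-eqb z = count-single _ z (eqb-refl z) (λ j → eqb-≡)

  count-remove : ∀ {n} (f : Fin n → Bool) i → f i ≡ true → count f ≡ suc (count (λ j → f j ∧ not (eqb j i)))
  count-remove f i e = trans (count-split f (λ j → eqb j i))
    (cong (_+ count (λ j → f j ∧ not (eqb j i)))
      (count-single (λ j → f j ∧ eqb j i) i (trans (cong (f i ∧_) (eqb-refl i)) (trans (∧-identityʳ (f i)) e)) onlyI))
    where onlyI : ∀ j → f j ∧ eqb j i ≡ true → j ≡ i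
          onlyI j p = eqb-≡ (∧-true₂ {f j} p)

  count-two : ∀ {n} (f : Fin n → Bool) i j → i ≢ j → f i ≡ true → f j ≡ true → 2 ≤ count f
  count-two f i j ne fi fj = subst (2 ≤_) (sym (count-remove f i fi))
    (s≤s (count-pos _ j (∧-intro fj (not-false (eqb-≢ (λ e → ne (sym e)))))))

  count-zero : ∀ {n} (f : Fin n → Bool) → count f ≡ 0 → ∀ v → f v ≡ false
  count-zero f e v with f v in fv
  ... | false = refl
  ... | true with subst (1 ≤_) e (count-pos f v fv)
  ... | ()

  count-one : ∀ {n} (f : Fin n → Bool) → count f ≡ 1 → ∀ u v → f u ≡ true → f v ≡ true → u ≡ v
  count-one f e u v fu fv with u ≟F v
  ... | yes q = q
  ... | no ne with subst (2 ≤_) e (count-two f u v ne fu fv)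
  ... | s≤s ()

  count-allBut : ∀ {n} (v : Fin n) → suc (count (λ u → not (eqb u v))) ≡ n
  count-allBut {n} v = sym (trans (sym (count-all (λ _ → true) (λ _ → refl))) (count-remove (λ _ → true) v refl))

  count-allBut2 : ∀ {n} (v w : Fin n) → v ≢ w → suc (suc (count (λ u → not (eqb u v) ∧ not (eqb u w)))) ≡ n
  count-allBut2 v w ne = trans (cong suc (sym (count-remove (λ u → not (eqb u v)) w (not-false (eqb-≢ (λ e → ne (sym e)))))))
    (count-allBut v)

  parity-double : ∀ m → parity (m + m) ≡ 0ℙ
  parity-double m = trans (+-homo-+ m m) (p+p≡0ℙ (parity m))

  parity-suc : ∀ k → parity (suc k) ≡ parity k ⁻¹
  parity-suc k = +-homo-+ 1 k

  parity-unchanged : ∀ a x → parity (a + x) ≡ parity a → parity x ≡ 0ℙ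
  parity-unchanged a x e = ℙ.+-cancelˡ-≡ (parity a) _ _
    (trans (sym (+-homo-+ a x)) (trans e (sym (ℙ.+-identityʳ (parity a)))))

  even⇒2∣ : ∀ x → parity x ≡ 0ℙ → 2 ∣ x
  even⇒2∣ zero _ = divides 0 refl
  even⇒2∣ (suc (suc x)) p with even⇒2∣ x p
  ... | divides q e = divides (suc q) (cong (2 +_) e)

  2∣⇒even : ∀ x → 2 ∣ x → parity x ≡ 0ℙ
  2∣⇒even x (divides q refl) = trans (*-homo-* q 2) (ℙ.*-zeroʳ (parity q))

  double-injective : ∀ x y → x + x ≡ y + y → x ≡ y
  double-injective zero zero e = refl
  double-injective (suc x) (suc y) e = cong suc (double-injective x y
    (suc-injective (trans (sym (+-suc x x)) (trans (suc-injective e) (+-suc y y)))))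

  even-≥4 : ∀ x → parity x ≡ 0ℙ → 1 ≤ x → x ≢ 2 → 4 ≤ x
  even-≥4 (suc (suc zero)) _ _ ne = ⊥-elim (ne refl)
  even-≥4 (suc (suc (suc (suc x)))) _ _ _ = s≤s (s≤s (s≤s (s≤s z≤n)))

  odd-≥3 : ∀ k → parity k ≡ 1ℙ → 2 ≤ k → 3 ≤ k
  odd-≥3 (suc zero) _ (s≤s ())
  odd-≥3 (suc (suc (suc k))) _ _ = s≤s (s≤s (s≤s z≤n))

  0ℙ≢1ℙ : 0ℙ ≢ 1ℙ
  0ℙ≢1ℙ ()

  parity-+1 : ∀ x → parity (x + 1) ≡ parity x ⁻¹
  parity-+1 x = trans (cong parity (+-comm x 1)) (parity-suc x)

  parity-+2 : ∀ x → parity (x + 2) ≡ parity x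
  parity-+2 x = cong parity (+-comm x 2)

  -- The balance s + u ≡ k + c, for s even, u ≤ 1 and c small, determines s
  -- from k.  (In a split graph: s is twice the size of a maximal matching, k
  -- the clique size, u the number of unmatched clique vertices and c the
  -- number of matched independent vertices.)
  balance-even : ∀ {s k} u c → parity s ≡ 0ℙ → parity k ≡ 0ℙ → s + u ≡ k + c → u ≤ 1 → c ≤ 1 → s ≡ k
  balance-even {s} {k} 0 0 _ _ e _ _ = +-cancelʳ-≡ 0 s k e
  balance-even {s} {k} 1 1 _ _ e _ _ = +-cancelʳ-≡ 1 s k e
  balance-even {s} {k} 0 1 ps pk e _ _ =
    ⊥-elim (0ℙ≢1ℙ (trans (sym ps) (trans (cong parity (trans (sym (+-identityʳ s)) e)) (trans (parity-+1 k) (cong _⁻¹ pk)))))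
  balance-even {s} {k} 1 0 ps pk e _ _ =
    ⊥-elim (0ℙ≢1ℙ (trans (sym pk) (trans (cong parity (trans (sym (+-identityʳ k)) (sym e))) (trans (parity-+1 s) (cong _⁻¹ ps)))))
  balance-even (suc (suc _)) _ _ _ _ (s≤s ()) _
  balance-even _ (suc (suc _)) _ _ _ _ (s≤s ())

  balance-odd : ∀ {s k} u c → parity s ≡ 0ℙ → parity k ≡ 1ℙ → s + u ≡ k + c → u ≤ 1 → c ≤ 2 →
    (u ≡ 1 → 1 ≤ c) → s ≡ suc k
  balance-odd {s} {k} 0 1 _ _ e _ _ _ = trans (sym (+-identityʳ s)) (trans e (+-comm k 1))
  balance-odd {s} {k} 1 2 _ _ e _ _ _ = +-cancelʳ-≡ 1 s (suc k) (trans e (+-suc k 1))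
  balance-odd {s} {k} 0 0 ps pk e _ _ _ =
    ⊥-elim (0ℙ≢1ℙ (trans (sym ps) (trans (cong parity (+-cancelʳ-≡ 0 s k e)) pk)))
  balance-odd {s} {k} 0 2 ps pk e _ _ _ =
    ⊥-elim (0ℙ≢1ℙ (trans (sym ps) (trans (cong parity (trans (sym (+-identityʳ s)) e)) (trans (parity-+2 k) pk))))
  balance-odd {s} {k} 1 1 ps pk e _ _ _ =
    ⊥-elim (0ℙ≢1ℙ (trans (sym ps) (trans (cong parity (+-cancelʳ-≡ 1 s k e)) pk)))
  balance-odd 1 0 _ _ _ _ _ needsC with needsC refl
  ... | ()
  balance-odd (suc (suc _)) _ _ _ _ (s≤s ()) _ _
  balance-odd _ (suc (suc (suc _))) _ _ _ _ (s≤s (s≤s ())) _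

  balance-odd₀ : ∀ {s k} u → parity s ≡ 0ℙ → parity k ≡ 1ℙ → s + u ≡ k + 0 → u ≤ 1 → suc s ≡ k
  balance-odd₀ {s} {k} 1 _ _ e _ = trans (+-comm 1 s) (trans e (+-identityʳ k))
  balance-odd₀ {s} {k} 0 ps pk e _ =
    ⊥-elim (0ℙ≢1ℙ (trans (sym ps) (trans (cong parity (+-cancelʳ-≡ 0 s k e)) pk)))
  balance-odd₀ (suc (suc _)) _ _ _ (s≤s ())

module GraphBasics {n : ℕ} (G : Graph n) where

  open import Data.Empty using (⊥-elim)
  open import Data.Bool using (Bool; true; false)
  open import Relation.Binary.PropositionalEquality
  open Graph G renaming (sym to adj-sym)
  open Counting using (true≢false)

  Adj-sym : ∀ {u v} → Adj G u v → Adj G v u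
  Adj-sym {u} {v} p = trans (adj-sym v u) p

  Adj⇒≢ : ∀ {u v} → Adj G u v → u ≢ v
  Adj⇒≢ {u} uv refl = true≢false (trans (sym uv) (irrefl u))

  ¬Adj⇒false : ∀ {u v} → ¬ Adj G u v → adj u v ≡ false
  ¬Adj⇒false {u} {v} h with adj u v
  ... | true = ⊥-elim (h refl)
  ... | false = refl

  false⇒¬Adj : ∀ {u v} → adj u v ≡ false → ¬ Adj G u v
  false⇒¬Adj e q = true≢false (trans (sym q) e)

  Clique : (Fin n → Bool) → Set
  Clique C = ∀ u v → u ≢ v → C u ≡ true → C v ≡ true → Adj G u v

  IndependentRest : (Fin n → Bool) → Set
  IndependentRest C = ∀ u v → C u ≡ false → C v ≡ false → ¬ Adj G u v

module Matchings {n : ℕ} (G : Graph n) where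

  open import Data.Nat
  open import Data.Nat.Properties
  open import Data.Bool using (Bool; true; false; _∧_; _∨_; not)
  open import Data.Bool.Properties using (∧-zeroʳ; ∧-comm) renaming (_≟_ to _≟B_)
  open import Data.Fin.Properties using () renaming (_≟_ to _≟F_)
  open import Data.List using (List; []; _∷_; length; filter; allFin; _++_)
  open import Data.List.Properties using (length-++)
  open import Data.List.Relation.Unary.All using (All; []; _∷_)
  import Data.List.Relation.Unary.All as All
  import Data.List.Relation.Unary.All.Properties as AllP
  open import Data.List.Relation.Unary.Any using (here; there)
  open import Data.List.Relation.Unary.AllPairs using ([]; _∷_)
  open import Data.List.Relation.Unary.Unique.Propositional using (Unique)
  import Data.List.Relation.Unary.Unique.Propositional.Properties as UniqueP
  open import Data.List.Membership.Propositional using (_∈_; _∉_)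
  import Data.List.Membership.Propositional.Properties as MemP
  open import Data.List.Membership.DecPropositional (_≟F_ {n}) using (_∈?_)
  open import Data.Product hiding (swap)
  open import Data.Sum
  open import Data.Empty
  open import Relation.Nullary
  open import Relation.Binary.PropositionalEquality
  open Counting
  open GraphBasics G

  ends : List (Edge G) → List (Fin n)
  ends = endpoints G

  -- Boolean membership, so that sets of matched vertices can be counted.
  memb : List (Fin n) → Fin n → Bool
  memb xs v = does (v ∈? xs)

  memb-true : ∀ {xs v} → memb xs v ≡ true → v ∈ xs
  memb-true {xs} {v} p with v ∈? xs
  ... | yes q = q

  memb-intro : ∀ {xs v} → v ∈ xs → memb xs v ≡ true
  memb-intro {xs} {v} p with v ∈? xs
  ... | yes q = refl
  ... | no q = ⊥-elim (q p)

  memb-false : ∀ {xs v} → memb xs v ≡ false → v ∉ xs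
  memb-false {xs} {v} p q with v ∈? xs
  ... | no r = r q

  length-ends : ∀ M → length (ends M) ≡ length M + length M
  length-ends [] = refl
  length-ends ((u , v) ∷ M) = cong suc (trans (cong suc (length-ends M)) (sym (+-suc (length M) (length M))))

  count-unique : ∀ xs → Unique xs → count (memb xs) ≡ length xs
  count-unique [] u = count-none (memb []) (λ _ → refl)
  count-unique (x ∷ xs) (x∉xs ∷ u) = begin
      count (memb (x ∷ xs))
    ≡⟨ sym (+-identityʳ _) ⟩
      count (λ v → eqb v x ∨ memb xs v) + 0
    ≡⟨ cong (count (λ v → eqb v x ∨ memb xs v) +_) (sym (count-none _ disjoint)) ⟩
      count (λ v → eqb v x ∨ memb xs v) + count (λ v → eqb v x ∧ memb xs v)
    ≡⟨ count-∨ (λ v → eqb v x) (memb xs) ⟩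
      count (λ v → eqb v x) + count (memb xs)
    ≡⟨ cong₂ _+_ (count-eqb x) (count-unique xs u) ⟩
      suc (length xs) ∎
    where
    open ≡-Reasoning
    disjoint : ∀ v → eqb v x ∧ memb xs v ≡ false
    disjoint v with v ≟F x
    ... | no _ = refl
    ... | yes refl with v ∈? xs
    ... | no _ = refl
    ... | yes q = ⊥-elim (All.lookup x∉xs q refl)

  IsEnd : Fin n → Edge G → Set
  IsEnd x (a , b) = x ≡ a ⊎ x ≡ b

  ends→edge : ∀ {x} M → x ∈ ends M → Σ (Edge G) λ e → e ∈ M × IsEnd x e
  ends→edge ((a , b) ∷ M) (here p) = (a , b) , here refl , inj₁ p
  ends→edge ((a , b) ∷ M) (there (here p)) = (a , b) , here refl , inj₂ p
  ends→edge ((a , b) ∷ M) (there (there q)) with ends→edge M q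
  ... | e , m , end = e , there m , end

  edge→ends : ∀ {x e} M → e ∈ M → IsEnd x e → x ∈ ends M
  edge→ends ((a , b) ∷ M) (here refl) (inj₁ p) = here p
  edge→ends ((a , b) ∷ M) (here refl) (inj₂ p) = there (here p)
  edge→ends ((a , b) ∷ M) (there m) end = there (there (edge→ends M m end))

  unique-edge : ∀ M → Unique (ends M) → ∀ {x e f} → e ∈ M → f ∈ M → IsEnd x e → IsEnd x f → e ≡ f
  unique-edge ((a , b) ∷ M) u (here refl) (here refl) _ _ = refl
  unique-edge ((a , b) ∷ M) (a∉ ∷ b∉ ∷ u) (here refl) (there mf) ea ef = ⊥-elim (notHere ea)
    where
    notHere : IsEnd _ (a , b) → ⊥
    notHere (inj₁ refl) = All.lookup a∉ (there (edge→ends M mf ef)) refl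
    notHere (inj₂ refl) = All.lookup b∉ (edge→ends M mf ef) refl
  unique-edge ((a , b) ∷ M) (a∉ ∷ b∉ ∷ u) (there me) (here refl) ee ef = ⊥-elim (notHere ef)
    where
    notHere : IsEnd _ (a , b) → ⊥
    notHere (inj₁ refl) = All.lookup a∉ (there (edge→ends M me ee)) refl
    notHere (inj₂ refl) = All.lookup b∉ (edge→ends M me ee) refl
  unique-edge ((a , b) ∷ M) (_ ∷ _ ∷ u) (there me) (there mf) ee ef = unique-edge M u me mf ee ef

  same-refl : ∀ {e} → SameEdge G e e
  same-refl {a , b} = inj₁ (refl , refl)

  same-sym : ∀ {e f} → SameEdge G e f → SameEdge G f e
  same-sym {a , b} {c , d} (inj₁ (refl , refl)) = inj₁ (refl , refl)
  same-sym {a , b} {c , d} (inj₂ (refl , refl)) = inj₂ (refl , refl)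

  same-trans : ∀ {e f g} → SameEdge G e f → SameEdge G f g → SameEdge G e g
  same-trans {a , b} {c , d} {g₁ , g₂} (inj₁ (refl , refl)) q = q
  same-trans {a , b} {c , d} {g₁ , g₂} (inj₂ (refl , refl)) (inj₁ (refl , refl)) = inj₂ (refl , refl)
  same-trans {a , b} {c , d} {g₁ , g₂} (inj₂ (refl , refl)) (inj₂ (refl , refl)) = inj₁ (refl , refl)

  same-end : ∀ {x e f} → SameEdge G e f → IsEnd x e → IsEnd x f
  same-end {x} {a , b} {c , d} (inj₁ (refl , refl)) end = end
  same-end {x} {a , b} {c , d} (inj₂ (refl , refl)) (inj₁ p) = inj₂ p
  same-end {x} {a , b} {c , d} (inj₂ (refl , refl)) (inj₂ p) = inj₁ p

  ∈E→∈ : ∀ {e} M → (_∈E_ G e M) → Σ (Edge G) λ f → f ∈ M × SameEdge G e f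
  ∈E→∈ (f ∷ M) (here p) = f , here refl , p
  ∈E→∈ (f ∷ M) (there q) with ∈E→∈ M q
  ... | g , m , s = g , there m , s

  ∈→∈E : ∀ {e f} M → f ∈ M → SameEdge G e f → _∈E_ G e M
  ∈→∈E (g ∷ M) (here refl) s = here s
  ∈→∈E (g ∷ M) (there m) s = there (∈→∈E M m s)

  Covered : List (Edge G) → Fin n → Set
  Covered M v = v ∈ ends M

  CoversEdges : List (Edge G) → Set
  CoversEdges M = ∀ u v → Adj G u v → Covered M u ⊎ Covered M v

  -- A maximal matching covers every edge, since an uncovered edge could be added.
  maximal⇒covers : ∀ M → IsMaximalMatching G M → CoversEdges M
  maximal⇒covers M ((allAdj , uniq) , maximal) u v uv with u ∈? ends M | v ∈? ends M
  ... | yes p | _ = inj₁ p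
  ... | no p | yes q = inj₂ q
  ... | no p | no q = ⊥-elim (p (edge→ends M f∈M (same-end u~f (inj₁ refl))))
    where
    bigger : IsMatching G ((u , v) ∷ M)
    bigger = (uv ∷ allAdj) ,
      ((Adj⇒≢ uv ∷ All.tabulate (λ m r → p (subst (_∈ ends M) (sym r) m))) ∷
       (All.tabulate (λ m r → q (subst (_∈ ends M) (sym r) m)) ∷ uniq))
    uvInM : Σ (Edge G) λ f → f ∈ M × SameEdge G (u , v) f
    uvInM = ∈E→∈ M (maximal _ bigger (λ e i → there i) (u , v) (here same-refl))
    f∈M : proj₁ uvInM ∈ M
    f∈M = proj₁ (proj₂ uvInM)
    u~f : SameEdge G (u , v) (proj₁ uvInM)
    u~f = proj₂ (proj₂ uvInM)

  -- Conversely a matching covering every edge is maximal: an edge of a larger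
  -- matching meets an edge of M in a covered endpoint, hence equals it.
  covers⇒maximal : ∀ M → IsMatching G M → CoversEdges M → IsMaximalMatching G M
  covers⇒maximal M isM cov = isM , λ M' isM' M⊆M' e e∈M' → inM M' isM' M⊆M' e (∈E→∈ M' e∈M')
    where
    throughEnd : ∀ M' → IsMatching G M' → _⊆E_ G M M' → ∀ e e' x →
      e' ∈ M' → SameEdge G e e' → IsEnd x e' → x ∈ ends M → _∈E_ G e M
    throughEnd M' isM' M⊆M' e e' x e'∈M' e~e' xe' xM with ends→edge M xM
    ... | f , f∈M , xf with ∈E→∈ M' (M⊆M' f (∈→∈E M f∈M same-refl))
    ... | f' , f'∈M' , f~f' with unique-edge M' (proj₂ isM') e'∈M' f'∈M' xe' (same-end f~f' xf)
    ... | refl = ∈→∈E M f∈M (same-trans e~e' (same-sym f~f'))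
    inM : ∀ M' → IsMatching G M' → _⊆E_ G M M' → ∀ e →
      (Σ (Edge G) λ f → f ∈ M' × SameEdge G e f) → _∈E_ G e M
    inM M' isM' M⊆M' e ((a , b) , e'∈M' , e~e') with cov a b (All.lookup (proj₁ isM') e'∈M')
    ... | inj₁ aM = throughEnd M' isM' M⊆M' e (a , b) a e'∈M' e~e' (inj₁ refl) aM
    ... | inj₂ bM = throughEnd M' isM' M⊆M' e (a , b) b e'∈M' e~e' (inj₂ refl) bM

  partner : ∀ M → IsMatching G M → ∀ x → Covered M x →
    Σ (Fin n) λ y → Adj G x y × Σ (Edge G) λ e → e ∈ M × IsEnd x e × IsEnd y e
  partner M isM x xM with ends→edge M xM
  ... | (a , b) , m , inj₁ refl = b , All.lookup (proj₁ isM) m , (a , b) , m , inj₁ refl , inj₂ refl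
  ... | (a , b) , m , inj₂ refl = a , Adj-sym (All.lookup (proj₁ isM) m) , (a , b) , m , inj₂ refl , inj₁ refl

  partner-injective : ∀ M → IsMatching G M → ∀ x x' z → x ≢ x' → x ≢ z → x' ≢ z →
     (Σ (Edge G) λ e → e ∈ M × IsEnd x e × IsEnd z e) →
     (Σ (Edge G) λ e → e ∈ M × IsEnd x' e × IsEnd z e) → ⊥
  partner-injective M isM x x' z xx' xz x'z (e , m , ex , ez) (e' , m' , ex' , ez')
    with unique-edge M (proj₂ isM) m m' ez ez'
  partner-injective M isM x x' z xx' xz x'z ((a , b) , m , ex , ez) (e' , m' , ex' , ez') | refl = threeEnds ex ex' ez
    where
    threeEnds : IsEnd x (a , b) → IsEnd x' (a , b) → IsEnd z (a , b) → ⊥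
    threeEnds (inj₁ refl) (inj₁ refl) _ = xx' refl
    threeEnds (inj₂ refl) (inj₂ refl) _ = xx' refl
    threeEnds (inj₁ refl) (inj₂ refl) (inj₁ refl) = xz refl
    threeEnds (inj₁ refl) (inj₂ refl) (inj₂ refl) = x'z refl
    threeEnds (inj₂ refl) (inj₁ refl) (inj₁ refl) = x'z refl
    threeEnds (inj₂ refl) (inj₁ refl) (inj₂ refl) = xz refl

  -- If every vertex marked by P is a pendant attached to z (and z is not
  -- marked), a matching covers at most one of them: all would be partnered with z.
  pendants-covered≤1 : ∀ M → IsMatching G M → (P : Fin n → Bool) (z : Fin n) → P z ≡ false →
    (∀ a → P a ≡ true → ∀ b → Adj G a b → b ≡ z) → count (λ v → memb (ends M) v ∧ P v) ≤ 1
  pendants-covered≤1 M isM P z pz onlyZ = count-atMostOne _ sameVertex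
    where
    ≢z : ∀ {i} → P i ≡ true → i ≢ z
    ≢z p refl = true≢false (trans (sym p) pz)
    sameVertex : ∀ i j → memb (ends M) i ∧ P i ≡ true → memb (ends M) j ∧ P j ≡ true → i ≡ j
    sameVertex i j p q with i ≟F j
    ... | yes e = e
    ... | no ne with partner M isM i (memb-true (∧-true₁ p)) | partner M isM j (memb-true (∧-true₁ q))
    ... | pi , ai , ei , mi , xi , zi | pj , aj , ej , mj , xj , zj
      with onlyZ i (∧-true₂ p) pi ai | onlyZ j (∧-true₂ q) pj aj
    ... | refl | refl = ⊥-elim (partner-injective M isM i j z ne (≢z (∧-true₂ p)) (≢z (∧-true₂ q))
                                 (ei , mi , xi , zi) (ej , mj , xj , zj))

  -- At most
  -- one clique vertex is unmatched (two would span an addable edge), so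
  -- 2|M| + (unmatched clique vertices) = |C| + (matched outside vertices).
  module SplitMatchingSize (C : Fin n → Bool) (clique : Clique C)
                           (M : List (Edge G)) (maxM : IsMaximalMatching G M) where

    matched : Fin n → Bool
    matched = memb (ends M)

    matchedInC matchedOutC unmatchedInC : ℕ
    matchedInC = count (λ v → matched v ∧ C v)
    matchedOutC = count (λ v → matched v ∧ not (C v))
    unmatchedInC = count (λ v → C v ∧ not (matched v))

    twice-size : length M + length M ≡ matchedInC + matchedOutC
    twice-size = trans (sym (length-ends M))
      (trans (sym (count-unique _ (proj₂ (proj₁ maxM)))) (count-split matched C))

    clique-size : count C ≡ matchedInC + unmatchedInC
    clique-size = trans (count-split C matched)
      (cong (_+ unmatchedInC) (count-ext (λ v → ∧-comm (C v) (matched v))))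

    -- Two unmatched clique vertices would span an edge that M fails to cover.
    unmatchedInC≤1 : unmatchedInC ≤ 1
    unmatchedInC≤1 = count-atMostOne _ sameVertex
      where
      sameVertex : ∀ i j → C i ∧ not (matched i) ≡ true → C j ∧ not (matched j) ≡ true → i ≡ j
      sameVertex i j p q with i ≟F j
      ... | yes e = e
      ... | no ne with maximal⇒covers M maxM i j (clique i j ne (∧-true₁ p) (∧-true₁ q))
      ... | inj₁ c = ⊥-elim (memb-false (not-true (∧-true₂ {C i} p)) c)
      ... | inj₂ c = ⊥-elim (memb-false (not-true (∧-true₂ {C j} q)) c)

    balance : (length M + length M) + unmatchedInC ≡ count C + matchedOutC
    balance = begin
        (length M + length M) + unmatchedInC   ≡⟨ cong (_+ unmatchedInC) twice-size ⟩
        (matchedInC + matchedOutC) + unmatchedInC ≡⟨ +-assoc matchedInC _ _ ⟩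
        matchedInC + (matchedOutC + unmatchedInC) ≡⟨ cong (matchedInC +_) (+-comm matchedOutC _) ⟩
        matchedInC + (unmatchedInC + matchedOutC) ≡⟨ sym (+-assoc matchedInC _ _) ⟩
        (matchedInC + unmatchedInC) + matchedOutC ≡⟨ cong (_+ matchedOutC) (sym clique-size) ⟩
        count C + matchedOutC                   ∎
      where open ≡-Reasoning

    size-even : parity (count C) ≡ 0ℙ → matchedOutC ≤ 1 → length M + length M ≡ count C
    size-even pC out≤1 = balance-even unmatchedInC matchedOutC (parity-double (length M)) pC balance unmatchedInC≤1 out≤1

    size-odd₀ : parity (count C) ≡ 1ℙ → matchedOutC ≡ 0 → suc (length M + length M) ≡ count C
    size-odd₀ pC out≡0 = balance-odd₀ unmatchedInC (parity-double (length M)) pC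
      (trans balance (cong (count C +_) out≡0)) unmatchedInC≤1

    -- |C| odd, at most two outside vertices matched, and every clique vertex has
    -- an outside neighbour (so an unmatched clique vertex forces a matched
    -- outside vertex): |M| = (|C| + 1)/2.
    size-odd : parity (count C) ≡ 1ℙ → matchedOutC ≤ 2 →
      (∀ w → C w ≡ true → Σ (Fin n) λ x → C x ≡ false × Adj G w x) →
      length M + length M ≡ suc (count C)
    size-odd pC out≤2 outsideNeighbour =
      balance-odd unmatchedInC matchedOutC (parity-double (length M)) pC balance unmatchedInC≤1 out≤2 someMatchedOut
      where
      someMatchedOut : unmatchedInC ≡ 1 → 1 ≤ matchedOutC
      someMatchedOut e with count-witness _ (λ z → 1≢0 (trans (sym e) z))
        where 1≢0 : 1 ≢ 0
              1≢0 ()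
      ... | w , p with outsideNeighbour w (∧-true₁ p)
      ... | x , xOut , wx with maximal⇒covers M maxM w x wx
      ... | inj₁ c = ⊥-elim (memb-false (not-true (∧-true₂ {C w} p)) c)
      ... | inj₂ c = count-pos _ x (∧-intro (memb-intro c) (not-false xOut))

  pairUp : List (Fin n) → List (Edge G)
  pairUp [] = []
  pairUp (a ∷ []) = []
  pairUp (a ∷ b ∷ r) = (a , b) ∷ pairUp r

  ends-pairUp : ∀ L → parity (length L) ≡ 0ℙ → ends (pairUp L) ≡ L
  ends-pairUp [] p = refl
  ends-pairUp (a ∷ b ∷ r) p = cong (λ t → a ∷ b ∷ t) (ends-pairUp r p)

  ends-++ : ∀ E F → ends (E ++ F) ≡ ends E ++ ends F
  ends-++ [] F = refl
  ends-++ ((a , b) ∷ E) F = cong (λ t → a ∷ b ∷ t) (ends-++ E F)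

  listOf : (Fin n → Bool) → List (Fin n)
  listOf f = filter (λ v → f v ≟B true) (allFin n)

  length-listOf : ∀ f → length (listOf f) ≡ count f
  length-listOf f = trans (length-filter-allFin (λ v → f v ≟B true)) (count-ext (λ v → does-≟true (f v)))
    where
    does-≟true : ∀ b → does (b ≟B true) ≡ b
    does-≟true true = refl
    does-≟true false = refl

  listOf-sound : ∀ f {v} → v ∈ listOf f → f v ≡ true
  listOf-sound f m = proj₂ (MemP.∈-filter⁻ (λ v → f v ≟B true) {xs = allFin n} m)

  listOf-complete : ∀ f {v} → f v ≡ true → v ∈ listOf f
  listOf-complete f {v} p = MemP.∈-filter⁺ (λ v → f v ≟B true) (MemP.∈-allFin v) p

  listOf-unique : ∀ f → Unique (listOf f)
  listOf-unique f = UniqueP.filter⁺ (λ v → f v ≟B true) (UniqueP.allFin⁺ n)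

  -- The
  -- clique vertices are split into a reserved list R (containing the clique
  -- vertices of E0) and the rest, which is paired up inside the clique; this
  -- needs |C| - |R| even.
  module Extension (C : Fin n → Bool) (clique : Clique C) (independent : IndependentRest C) where

    pairUp-edges : ∀ L → Unique L → All (λ v → C v ≡ true) L → All (λ { (u , v) → Adj G u v }) (pairUp L)
    pairUp-edges [] _ _ = []
    pairUp-edges (a ∷ []) _ _ = []
    pairUp-edges (a ∷ b ∷ r) ((a≢b ∷ _) ∷ (_ ∷ u)) (ca ∷ cb ∷ c) = clique a b a≢b ca cb ∷ pairUp-edges r u c

    module Extend (E0 : List (Edge G)) (isE0 : IsMatching G E0)
      (R : List (Fin n)) (uniqR : Unique R) (R⊆C : All (λ b → C b ≡ true) R)
      (E0∩C⊆R : ∀ v → v ∈ ends E0 → C v ≡ true → v ∈ R)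
      (parityOK : parity (count C) ≡ parity (length R))
      (reservedOK : ∀ u → u ∈ R → u ∈ ends E0 ⊎ (∀ v → Adj G u v → C v ≡ true × v ∉ R)) where

      free : Fin n → Bool
      free v = C v ∧ not (memb R v)
      L : List (Fin n)
      L = listOf free
      splitC : count C ≡ length R + length L
      splitC = trans (count-split C (memb R))
        (cong₂ _+_ (trans (count-ext inR) (count-unique R uniqR)) (sym (length-listOf free)))
        where
        inR : ∀ v → C v ∧ memb R v ≡ memb R v
        inR v with v ∈? R
        ... | no _ = ∧-zeroʳ (C v)
        ... | yes m rewrite All.lookup R⊆C m = refl
      evenL : parity (length L) ≡ 0ℙ
      evenL = parity-unchanged (length R) (length L) (trans (sym (cong parity splitC)) parityOK)

      M : List (Edge G)
      M = E0 ++ pairUp L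
      endsM : ends M ≡ ends E0 ++ L
      endsM = trans (ends-++ E0 (pairUp L)) (cong (ends E0 ++_) (ends-pairUp L evenL))
      L⊆C : All (λ v → C v ≡ true) L
      L⊆C = All.tabulate (λ m → ∧-true₁ (listOf-sound free m))
      disjoint : ∀ {x} → ¬ (x ∈ ends E0 × x ∈ L)
      disjoint (m1 , m2) with listOf-sound free m2
      ... | p = memb-false (not-true (∧-true₂ p)) (E0∩C⊆R _ m1 (∧-true₁ p))
      isM : IsMatching G M
      isM = AllP.++⁺ (proj₁ isE0) (pairUp-edges L (listOf-unique free) L⊆C) ,
            subst Unique (sym endsM) (UniqueP.++⁺ (proj₂ isE0) (listOf-unique free) disjoint)
      inM : ∀ {v} → v ∈ ends E0 ⊎ v ∈ L → Covered M v
      inM (inj₁ m) = subst (_ ∈_) (sym endsM) (MemP.∈-++⁺ˡ m)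
      inM (inj₂ m) = subst (_ ∈_) (sym endsM) (MemP.∈-++⁺ʳ (ends E0) m)
      inL : ∀ {v} → C v ≡ true → v ∉ R → v ∈ L
      inL {v} c v∉R = listOf-complete free (∧-intro c (not-false notInR))
        where notInR : memb R v ≡ false
              notInR with v ∈? R
              ... | yes m = ⊥-elim (v∉R m)
              ... | no _ = refl
      coversFromClique : ∀ x y → C x ≡ true → Adj G x y → Covered M x ⊎ Covered M y
      coversFromClique x y cx xy with x ∈? R
      ... | no x∉R = inj₁ (inM (inj₂ (inL cx x∉R)))
      ... | yes m with reservedOK x m
      ... | inj₁ e = inj₁ (inM (inj₁ e))
      ... | inj₂ h = inj₂ (inM (inj₂ (inL (proj₁ (h y xy)) (proj₂ (h y xy)))))
      coversM : CoversEdges M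
      coversM u v uv with C u in eu | C v in ev
      ... | true | _ = coversFromClique u v eu uv
      ... | false | true = swap (coversFromClique v u ev (Adj-sym uv))
      ... | false | false = ⊥-elim (independent u v eu ev uv)

      sizeEq : (length M + length M) + length R ≡ length (ends E0) + count C
      sizeEq = begin
          (length M + length M) + length R        ≡⟨ cong (_+ length R) (sym (length-ends M)) ⟩
          length (ends M) + length R             ≡⟨ cong (λ t → length t + length R) endsM ⟩
          length (ends E0 ++ L) + length R       ≡⟨ cong (_+ length R) (length-++ (ends E0)) ⟩
          (length (ends E0) + length L) + length R ≡⟨ +-assoc (length (ends E0)) _ _ ⟩
          length (ends E0) + (length L + length R) ≡⟨ cong (length (ends E0) +_) (trans (+-comm (length L) _) (sym splitC)) ⟩
          length (ends E0) + count C             ∎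
        where open ≡-Reasoning

    extend : (E0 : List (Edge G)) → IsMatching G E0 →
      (R : List (Fin n)) → Unique R → All (λ b → C b ≡ true) R →
      (∀ v → v ∈ ends E0 → C v ≡ true → v ∈ R) →
      parity (count C) ≡ parity (length R) →
      (∀ u → u ∈ R → u ∈ ends E0 ⊎ (∀ v → Adj G u v → C v ≡ true × v ∉ R)) →
      Σ (List (Edge G)) λ M → IsMaximalMatching G M × (length M + length M) + length R ≡ length (ends E0) + count C
    extend E0 isE0 R uniqR R⊆C E0∩C⊆R parityOK reservedOK = M , covers⇒maximal M isM coversM , sizeEq
      where open Extend E0 isE0 R uniqR R⊆C E0∩C⊆R parityOK reservedOK

-- Each is refuted by building,
-- with Matchings.extend, two maximal matchings of different sizes.
module ForbiddenConfigurations {n : ℕ} (G : Graph n) (eqm : Equimatchable G) (C : Fin n → Bool)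
       (clique : GraphBasics.Clique G C) (independent : GraphBasics.IndependentRest G C) where

  open import Data.Nat
  open import Data.Nat.Properties
  open import Data.Bool using (Bool; true; false)
  open import Data.List using (List; []; _∷_; length)
  open import Data.List.Relation.Unary.All using ([]; _∷_)
  open import Data.List.Relation.Unary.Any using (here; there)
  open import Data.List.Relation.Unary.AllPairs using ([]; _∷_)
  open import Data.List.Membership.Propositional using (_∈_; _∉_)
  open import Data.Product
  open import Data.Sum
  open import Data.Empty
  open import Relation.Binary.PropositionalEquality
  open Counting
  open GraphBasics G
  open Matchings G
  open Extension C clique independent

  k : ℕ
  k = count C

  CrossEdge : Fin n → Fin n → Set
  CrossEdge b a = C b ≡ true × C a ≡ false × Adj G b a

  in≢out : ∀ {x y} → C x ≡ true → C y ≡ false → x ≢ y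
  in≢out cx cy refl = true≢false (trans (sym cx) cy)

  sizes-agree : ∀ {M M'} c c' d d' → IsMaximalMatching G M → IsMaximalMatching G M' →
    (length M + length M) + c ≡ d + k → (length M' + length M') + c' ≡ d' + k → c + d' ≡ c' + d
  sizes-agree {M} {M'} c c' d d' maxM maxM' e e' = +-cancelˡ-≡ A _ _ (begin
      A + (c + d')   ≡⟨ sym (+-assoc A c d') ⟩
      (A + c) + d'   ≡⟨ cong (_+ d') e ⟩
      (d + k) + d'   ≡⟨ +-assoc d k d' ⟩
      d + (k + d')   ≡⟨ cong (d +_) (+-comm k d') ⟩
      d + (d' + k)   ≡⟨ cong (d +_) (sym (trans (cong (λ t → (t + t) + c') (eqm M M' maxM maxM')) e')) ⟩
      d + (A + c')   ≡⟨ sym (+-assoc d A c') ⟩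
      (d + A) + c'   ≡⟨ cong (_+ c') (+-comm d A) ⟩
      (A + d) + c'   ≡⟨ +-assoc A d c' ⟩
      A + (d + c')   ≡⟨ cong (A +_) (+-comm d c') ⟩
      A + (c' + d)   ∎)
    where
    open ≡-Reasoning
    A : ℕ
    A = length M + length M

  clique-matching : parity k ≡ 0ℙ →
    Σ (List (Edge G)) λ M → IsMaximalMatching G M × (length M + length M) + 0 ≡ 0 + k
  clique-matching pk = extend [] ([] , []) [] [] [] (λ v ()) pk (λ u ())

  one-cross-matching : ∀ {b a} → CrossEdge b a → parity k ≡ 1ℙ →
    Σ (List (Edge G)) λ M → IsMaximalMatching G M × (length M + length M) + 1 ≡ 2 + k
  one-cross-matching {b} {a} (cb , ca , ba) pk =
    extend ((b , a) ∷ []) ((ba ∷ []) , ((in≢out cb ca ∷ []) ∷ ([] ∷ [])))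
      (b ∷ []) ([] ∷ []) (cb ∷ []) cliqueEndsReserved pk (λ { u (here refl) → inj₁ (here refl) })
    where
    cliqueEndsReserved : ∀ v → v ∈ b ∷ a ∷ [] → C v ≡ true → v ∈ b ∷ []
    cliqueEndsReserved v (here refl) _ = here refl
    cliqueEndsReserved v (there (here refl)) cv = ⊥-elim (in≢out cv ca refl)

  -- |C| even: no two disjoint cross edges (they would give |C|/2 + 1 edges).
  no-two-cross-edges : parity k ≡ 0ℙ → ∀ {b1 a1 b2 a2} → CrossEdge b1 a1 → CrossEdge b2 a2 →
    b1 ≢ b2 → a1 ≢ a2 → ⊥
  no-two-cross-edges pk {b1} {a1} {b2} {a2} (c1 , i1 , e1) (c2 , i2 , e2) bb aa
    with clique-matching pk
       | extend ((b1 , a1) ∷ (b2 , a2) ∷ [])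
            ((e1 ∷ e2 ∷ []) ,
             ((in≢out c1 i1 ∷ bb ∷ in≢out c1 i2 ∷ []) ∷
              ((λ e → in≢out c2 i1 (sym e)) ∷ aa ∷ []) ∷ (in≢out c2 i2 ∷ []) ∷ [] ∷ []))
            (b1 ∷ b2 ∷ []) ((bb ∷ []) ∷ [] ∷ []) (c1 ∷ c2 ∷ []) cliqueEndsReserved pk reservedMatched
    where
    cliqueEndsReserved : ∀ v → v ∈ b1 ∷ a1 ∷ b2 ∷ a2 ∷ [] → C v ≡ true → v ∈ b1 ∷ b2 ∷ []
    cliqueEndsReserved v (here refl) _ = here refl
    cliqueEndsReserved v (there (here refl)) cv = ⊥-elim (in≢out cv i1 refl)
    cliqueEndsReserved v (there (there (here refl))) _ = there (here refl)
    cliqueEndsReserved v (there (there (there (here refl)))) cv = ⊥-elim (in≢out cv i2 refl)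
    reservedMatched : ∀ u → u ∈ b1 ∷ b2 ∷ [] → u ∈ b1 ∷ a1 ∷ b2 ∷ a2 ∷ [] ⊎ _
    reservedMatched u (here refl) = inj₁ (here refl)
    reservedMatched u (there (here refl)) = inj₁ (there (there (here refl)))
  ... | M0 , max0 , size0 | M2 , max2 , size2 with sizes-agree 0 2 0 4 max0 max2 size0 size2
  ... | ()

  -- |C| odd: if some clique vertex w has no outside neighbour, there is no
  -- cross edge at all (reserving w gives (|C| - 1)/2 edges).
  no-cross-edge-if-inner : parity k ≡ 1ℙ → ∀ w → C w ≡ true → (∀ x → C x ≡ false → ¬ Adj G w x) →
    ∀ {b a} → CrossEdge b a → ⊥
  no-cross-edge-if-inner pk w cw noOut cross
    with extend [] ([] , []) (w ∷ []) ([] ∷ []) (cw ∷ []) (λ v ()) pk (λ { u (here refl) → inj₂ allInside })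
       | one-cross-matching cross pk
    where
    allInside : ∀ v → Adj G w v → C v ≡ true × v ∉ (w ∷ [])
    allInside v wv with C v in cv
    ... | true = refl , λ { (here refl) → Adj⇒≢ wv refl }
    ... | false = ⊥-elim (noOut v cv wv)
  ... | M0 , max0 , size0 | M1 , max1 , size1 with sizes-agree 1 1 0 2 max0 max1 size0 size1
  ... | ()

  -- |C| odd: no three pairwise disjoint cross edges (they would give
  -- (|C| + 3)/2 edges, against (|C| + 1)/2 from a single cross edge).
  no-three-cross-edges : parity k ≡ 1ℙ → ∀ {b1 a1 b2 a2 b3 a3} →
    CrossEdge b1 a1 → CrossEdge b2 a2 → CrossEdge b3 a3 →
    b1 ≢ b2 → b1 ≢ b3 → b2 ≢ b3 → a1 ≢ a2 → a1 ≢ a3 → a2 ≢ a3 → ⊥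
  no-three-cross-edges pk {b1} {a1} {b2} {a2} {b3} {a3} x1@(c1 , i1 , e1) (c2 , i2 , e2) (c3 , i3 , e3)
                       b12 b13 b23 a12 a13 a23
    with one-cross-matching x1 pk
       | extend ((b1 , a1) ∷ (b2 , a2) ∷ (b3 , a3) ∷ [])
            ((e1 ∷ e2 ∷ e3 ∷ []) ,
             ((in≢out c1 i1 ∷ b12 ∷ in≢out c1 i2 ∷ b13 ∷ in≢out c1 i3 ∷ []) ∷
              ((λ e → in≢out c2 i1 (sym e)) ∷ a12 ∷ (λ e → in≢out c3 i1 (sym e)) ∷ a13 ∷ []) ∷
              (in≢out c2 i2 ∷ b23 ∷ in≢out c2 i3 ∷ []) ∷
              ((λ e → in≢out c3 i2 (sym e)) ∷ a23 ∷ []) ∷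
              (in≢out c3 i3 ∷ []) ∷ [] ∷ []))
            (b1 ∷ b2 ∷ b3 ∷ []) ((b12 ∷ b13 ∷ []) ∷ (b23 ∷ []) ∷ [] ∷ []) (c1 ∷ c2 ∷ c3 ∷ [])
            cliqueEndsReserved pk reservedMatched
    where
    cliqueEndsReserved : ∀ v → v ∈ b1 ∷ a1 ∷ b2 ∷ a2 ∷ b3 ∷ a3 ∷ [] → C v ≡ true → v ∈ b1 ∷ b2 ∷ b3 ∷ []
    cliqueEndsReserved v (here refl) _ = here refl
    cliqueEndsReserved v (there (here refl)) cv = ⊥-elim (in≢out cv i1 refl)
    cliqueEndsReserved v (there (there (here refl))) _ = there (here refl)
    cliqueEndsReserved v (there (there (there (here refl)))) cv = ⊥-elim (in≢out cv i2 refl)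
    cliqueEndsReserved v (there (there (there (there (here refl))))) _ = there (there (here refl))
    cliqueEndsReserved v (there (there (there (there (there (here refl)))))) cv = ⊥-elim (in≢out cv i3 refl)
    reservedMatched : ∀ u → u ∈ b1 ∷ b2 ∷ b3 ∷ [] → u ∈ b1 ∷ a1 ∷ b2 ∷ a2 ∷ b3 ∷ a3 ∷ [] ⊎ _
    reservedMatched u (here refl) = inj₁ (here refl)
    reservedMatched u (there (here refl)) = inj₁ (there (there (here refl)))
    reservedMatched u (there (there (here refl))) = inj₁ (there (there (there (there (here refl)))))
  ... | M1 , max1 , size1 | M3 , max3 , size3 with sizes-agree 1 3 2 6 max1 max3 size1 size3
  ... | ()

module Degrees {n : ℕ} (G : Graph n) where

  open import Data.Nat
  open import Data.Nat.Properties
  open import Data.Bool using (Bool; true; false; _∧_; not)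
  open import Data.Bool.Properties using () renaming (_≟_ to _≟B_)
  open import Data.Fin using (Fin)
  open import Data.Fin.Properties using () renaming (_≟_ to _≟F_)
  open import Data.Empty
  open import Relation.Nullary
  open import Relation.Nullary.Decidable using (dec-true; dec-false)
  open import Relation.Binary.PropositionalEquality
  open Graph G using (adj; irrefl)
  open Counting
  open GraphBasics G

  d : Fin n → ℕ
  d = deg G

  does-≟ : ∀ {m k} → does (m ≟ k) ≡ true → m ≡ k
  does-≟ {m} {k} = witness (m ≟ k)
    where witness : ∀ {A : Set} (a? : Dec A) → does a? ≡ true → A
          witness (yes a) _ = a

  deg≡count : ∀ v → d v ≡ count (adj v)
  deg≡count v = trans (length-filter-allFin (λ w → adj v w ≟B true)) (count-ext (λ w → does-≟true (adj v w)))
    where does-≟true : ∀ b → does (b ≟B true) ≡ b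
          does-≟true true = refl
          does-≟true false = refl

  hasDeg : ℕ → Fin n → Bool
  hasDeg k v = does (d v ≟ k)

  hasDeg-true : ∀ {k v} → d v ≡ k → hasDeg k v ≡ true
  hasDeg-true {k} {v} = dec-true (d v ≟ k)

  hasDeg-false : ∀ {k v} → d v ≢ k → hasDeg k v ≡ false
  hasDeg-false {k} {v} = dec-false (d v ≟ k)

  numDeg≡count : ∀ k → numDeg G k ≡ count (hasDeg k)
  numDeg≡count k = length-filter-allFin (λ v → d v ≟ k)

  numDeg-by : ∀ k (P : Fin n → Bool) → (∀ v → P v ≡ true → d v ≡ k) → (∀ v → P v ≡ false → d v ≢ k) →
    numDeg G k ≡ count P
  numDeg-by k P yes' no' = trans (numDeg≡count k) (count-ext agree)
    where agree : ∀ v → hasDeg k v ≡ P v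
          agree v with P v in e
          ... | true = hasDeg-true (yes' v e)
          ... | false = hasDeg-false (no' v e)

  deg-by : ∀ v (S : Fin n → Bool) → (∀ u → adj v u ≡ S u) → d v ≡ count S
  deg-by v S h = trans (deg≡count v) (count-ext h)

  nbhd-saturated : ∀ v (S : Fin n → Bool) → (∀ u → Adj G v u → S u ≡ true) → count S ≤ d v →
    ∀ u → S u ≡ true → Adj G v u
  nbhd-saturated v S sub le = count-saturate (adj v) S sub (subst (count S ≤_) (deg≡count v) le)

  deg-full : ∀ v → (∀ w → w ≢ v → Adj G v w) → suc (d v) ≡ n
  deg-full v h = trans (cong suc (deg-by v (λ u → not (eqb u v)) nbhd)) (count-allBut v)
    where nbhd : ∀ u → adj v u ≡ not (eqb u v)
          nbhd u with u ≟F v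
          ... | yes refl = irrefl u
          ... | no ne = h u ne

  full-deg : ∀ v → suc (d v) ≡ n → ∀ w → w ≢ v → Adj G v w
  full-deg v e w ne = count-saturate (adj v) (λ u → not (eqb u v))
    (λ u p → not-false (eqb-≢ (λ q → Adj⇒≢ p (sym q))))
    (≤-reflexive (suc-injective (trans (count-allBut v) (trans (sym e) (cong suc (deg≡count v))))))
    w (not-false (eqb-≢ ne))

  universal⇒deg : ∀ v → (∀ w → w ≢ v → Adj G v w) → d v ≡ n ∸ 1
  universal⇒deg v h = cong (_∸ 1) (deg-full v h)

  deg⇒universal : ∀ v → d v ≡ n ∸ 1 → 1 ≤ n → ∀ w → w ≢ v → Adj G v w
  deg⇒universal v e 1≤n = full-deg v (trans (cong suc e) (m∸n+n≡m? 1≤n))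
    where m∸n+n≡m? : 1 ≤ n → suc (n ∸ 1) ≡ n
          m∸n+n≡m? (s≤s _) = refl

  deg-one-miss : ∀ v w → w ≢ v → adj v w ≡ false → suc (suc (d v)) ≤ n
  deg-one-miss v w ne nw = subst (suc (suc (d v)) ≤_) (count-allBut2 v w (λ e → ne (sym e)))
    (s≤s (s≤s (subst (_≤ _) (sym (deg≡count v)) (count-mono (adj v) _ nbhd))))
    where nbhd : ∀ u → adj v u ≡ true → not (eqb u v) ∧ not (eqb u w) ≡ true
          nbhd u p = ∧-intro (not-false (eqb-≢ (λ q → Adj⇒≢ p (sym q))))
                             (not-false (eqb-≢ {i = u} {j = w} (λ { refl → true≢false (trans (sym p) nw) })))

  deg-two-misses : ∀ v w1 w2 → w1 ≢ v → w2 ≢ v → w1 ≢ w2 → adj v w1 ≡ false → adj v w2 ≡ false →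
    suc (suc (suc (d v))) ≤ n
  deg-two-misses v w1 w2 n1 n2 n12 a1 a2 =
    subst (_≤ n) (cong (suc ∘′ suc ∘′ suc) (sym (deg≡count v)))
      (subst (suc (suc (suc (count (adj v)))) ≤_)
        (trans (cong (suc ∘′ suc) (sym (count-remove others w2 w2Other))) (count-allBut2 v w1 (λ e → n1 (sym e))))
        (s≤s (s≤s (s≤s (count-mono (adj v) _ nbhd)))))
    where
    open import Function using (_∘′_)
    others : Fin n → Bool
    others u = not (eqb u v) ∧ not (eqb u w1)
    w2Other : others w2 ≡ true
    w2Other = ∧-intro (not-false (eqb-≢ n2)) (not-false (eqb-≢ (λ e → n12 (sym e))))
    nbhd : ∀ u → adj v u ≡ true → others u ∧ not (eqb u w2) ≡ true
    nbhd u p = ∧-intro (∧-intro (not-false (eqb-≢ (λ q → Adj⇒≢ p (sym q))))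
                                (not-false (eqb-≢ {i = u} {j = w1} λ { refl → true≢false (trans (sym p) a1) })))
                       (not-false (eqb-≢ {i = u} {j = w2} λ { refl → true≢false (trans (sym p) a2) }))

  non-universal : ∀ v w → w ≢ v → ¬ Adj G v w → d v ≢ n ∸ 1
  non-universal v w ne na e = too-big n (subst (λ t → suc (suc t) ≤ n) e (deg-one-miss v w ne (¬Adj⇒false na)))
    where too-big : ∀ m → ¬ (suc (suc (m ∸ 1)) ≤ m)
          too-big zero ()
          too-big (suc m) le = 1+n≰n (≤-pred le)

  deg-all-but-one : ∀ v w → w ≢ v → adj v w ≡ false → (∀ u → u ≢ v → u ≢ w → Adj G v u) → d v ≡ n ∸ 2
  deg-all-but-one v w ne nw h = cong (_∸ 2) (trans (cong (suc ∘′ suc) (deg-by v others nbhd))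
                                                 (count-allBut2 v w (λ e → ne (sym e))))
    where
    open import Function using (_∘′_)
    others : Fin n → Bool
    others u = not (eqb u v) ∧ not (eqb u w)
    nbhd : ∀ u → adj v u ≡ others u
    nbhd u with u ≟F v | u ≟F w
    ... | yes refl | _ = irrefl u
    ... | no _ | yes refl = nw
    ... | no a | no b = h u a b

  deg1-neighbour : ∀ v a b → d v ≡ 1 → Adj G v a → Adj G v b → a ≡ b
  deg1-neighbour v a b e va vb with a ≟F b
  ... | yes q = q
  ... | no ne with subst (2 ≤_) (trans (sym (deg≡count v)) e) (count-two (adj v) a b ne va vb)
  ... | s≤s ()

module Shapes {n : ℕ} (G : Graph n) where

  open import Data.Nat using (_≤_; parity)
  open import Data.Bool using (Bool; true; false; _∧_; not)
  open Counting using (count; eqb)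
  open GraphBasics G using (Clique)

  Complete : Set
  Complete = ∀ u v → u ≢ v → Adj G u v

  record Star : Set where
    constructor star
    field
      z : Fin n
      centre : ∀ u → u ≢ z → Adj G z u
      leaves : ∀ u v → u ≢ z → v ≢ z → ¬ Adj G u v

  record PendantClique : Set where
    constructor pendantClique
    field
      C : Fin n → Bool
      z : Fin n
      z∈C : C z ≡ true
      clique : Clique C
      pendant : ∀ a → C a ≡ false → Adj G a z × (∀ b → Adj G a b → b ≡ z)
      evenC : parity (count C) ≡ 0ℙ
      C≥4 : 4 ≤ count C
      pendants≥2 : 2 ≤ count (λ v → not (C v))

  record HubClique : Set where
    constructor hubClique
    field
      K : Fin n → Bool
      c a : Fin n
      c∈K : K c ≡ true
      a∉K : K a ≡ false
      a≁c : ¬ Adj G a c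
      clique : Clique K
      a~K : ∀ v → K v ≡ true → v ≢ c → Adj G a v
      pendant : ∀ q → K q ≡ false → q ≢ a → Adj G q c × (∀ b → Adj G q b → b ≡ c)
      oddK : parity (count K) ≡ 1ℙ
      pendants≥2 : 2 ≤ count (λ v → not (K v) ∧ not (eqb v a))
      K-nontrivial : Σ (Fin n) λ v → K v ≡ true × v ≢ c

  record CliquePlusPair : Set where
    constructor cliquePlusPair
    field
      oddN : parity n ≡ 1ℙ
      x y : Fin n
      x≢y : x ≢ y
      x≁y : ¬ Adj G x y
      dominated : ∀ w → w ≢ x → w ≢ y → Adj G w x ⊎ Adj G w y
      clique : ∀ u v → u ≢ v → u ≢ x → u ≢ y → v ≢ x → v ≢ y → Adj G u v

  Shape : Set
  Shape = Complete ⊎ Star ⊎ PendantClique ⊎ HubClique ⊎ CliquePlusPair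

module ShapesAreEquimatchableSplit {n : ℕ} (G : Graph n) where

  open import Data.Nat
  open import Data.Nat.Properties
  open import Data.Bool using (Bool; true; false; _∧_; _∨_; not)
  open import Data.Bool.Properties using (∧-zeroʳ; ∨-zeroʳ; ∨-identityʳ)
  open import Data.Fin.Properties using () renaming (_≟_ to _≟F_)
  open import Data.List using (length)
  open import Data.Product
  open import Data.Sum
  open import Data.Empty
  open import Relation.Nullary
  open import Relation.Binary.PropositionalEquality
  open Counting
  open GraphBasics G
  open Matchings G
  open Shapes G

  equimatchable-by : ∀ s → (∀ M → IsMaximalMatching G M → length M + length M ≡ s) → Equimatchable G
  equimatchable-by s h M M' maxM maxM' = double-injective _ _ (trans (h M maxM) (sym (h M' maxM')))

  complete-equimatchable-split : Complete → Equimatchable G × IsSplit G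
  complete-equimatchable-split complete = equimatchable , (C , clique , independent)
    where
    C : Fin n → Bool
    C _ = true
    clique : Clique C
    clique u v ne _ _ = complete u v ne
    independent : IndependentRest C
    independent u v ()
    noneOutside : ∀ M → count (λ v → memb (ends M) v ∧ not (C v)) ≡ 0
    noneOutside M = count-none _ (λ v → ∧-zeroʳ (memb (ends M) v))
    equimatchable : Equimatchable G
    equimatchable with parity (count C) in e
    ... | 0ℙ = equimatchable-by (count C) λ M maxM →
            SplitMatchingSize.size-even C clique M maxM e (subst (_≤ 1) (sym (noneOutside M)) z≤n)
    ... | 1ℙ = equimatchable-by (pred (count C)) λ M maxM →
            cong pred (SplitMatchingSize.size-odd₀ C clique M maxM e (noneOutside M))

  star-equimatchable-split : (s : Star) → (Σ (Fin n) λ u → u ≢ Star.z s) → Equimatchable G × IsSplit G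
  star-equimatchable-split (star z centre leaves) (u0 , u0≢z) = equimatchable , (C , clique , independent)
    where
    C : Fin n → Bool
    C v = eqb v z
    clique : Clique C
    clique u v ne cu cv = ⊥-elim (ne (trans (eqb-≡ cu) (sym (eqb-≡ cv))))
    independent : IndependentRest C
    independent u v cu cv = leaves u v (eqb-false cu) (eqb-false cv)
    oddC : parity (count C) ≡ 1ℙ
    oddC = cong parity (count-eqb z)
    onlyZ : ∀ a → not (C a) ≡ true → ∀ b → Adj G a b → b ≡ z
    onlyZ a pa b ab with b ≟F z
    ... | yes e = e
    ... | no ne = ⊥-elim (leaves a b (eqb-false (not-true pa)) ne ab)
    outsideNeighbour : ∀ w → C w ≡ true → Σ (Fin n) λ x → C x ≡ false × Adj G w x
    outsideNeighbour w cw with eqb-≡ {i = w} {j = z} cw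
    ... | refl = u0 , eqb-≢ u0≢z , centre u0 u0≢z
    equimatchable : Equimatchable G
    equimatchable = equimatchable-by (suc (count C)) λ M maxM →
      SplitMatchingSize.size-odd C clique M maxM oddC
        (≤-trans (pendants-covered≤1 M (proj₁ maxM) (λ v → not (C v)) z (cong not (eqb-refl z)) onlyZ) (s≤s z≤n))
        outsideNeighbour

  -- Pendant clique: at most one pendant is matched, so every maximal
  -- matching has |C|/2 edges.
  pendantClique-equimatchable-split : PendantClique → Equimatchable G × IsSplit G
  pendantClique-equimatchable-split (pendantClique C z z∈C clique pendant evenC _ _) =
    equimatchable , (C , clique , independent)
    where
    independent : IndependentRest C
    independent u v cu cv uv with proj₂ (pendant u cu) v uv
    ... | refl = true≢false (trans (sym z∈C) cv)
    equimatchable : Equimatchable G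
    equimatchable = equimatchable-by (count C) λ M maxM →
      SplitMatchingSize.size-even C clique M maxM evenC
        (pendants-covered≤1 M (proj₁ maxM) (λ v → not (C v)) z (cong not z∈C) (λ a pa → proj₂ (pendant a (not-true pa))))

  -- Hub clique: at most one pendant and a are matched, and every clique
  -- vertex has an outside neighbour, so every maximal matching has (|K|+1)/2 edges.
  hubClique-equimatchable-split : HubClique → Equimatchable G × IsSplit G
  hubClique-equimatchable-split (hubClique K c a c∈K a∉K a≁c clique a~K pendant oddK pendants≥2 _) =
    equimatchable , (K , clique , independent)
    where
    independent : IndependentRest K
    independent u v ku kv uv with u ≟F a
    ... | no u≢a with proj₂ (pendant u ku u≢a) v uv
    ... | refl = true≢false (trans (sym c∈K) kv)
    independent u v ku kv uv | yes refl with proj₂ (pendant v kv (λ e → Adj⇒≢ uv (sym e))) u (Adj-sym uv)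
    ... | refl = true≢false (trans (sym c∈K) a∉K)
    P : Fin n → Bool
    P v = not (K v) ∧ not (eqb v a)
    -- A matching covers at most one pendant and possibly a.
    matchedOutside≤2 : ∀ M → IsMatching G M → count (λ v → memb (ends M) v ∧ not (K v)) ≤ 2
    matchedOutside≤2 M isM = ≤-trans (count-mono _ (λ v → (memb (ends M) v ∧ P v) ∨ eqb v a) pendantOrA)
      (≤-trans (count-∨-≤ (λ v → memb (ends M) v ∧ P v) (λ v → eqb v a))
               (+-mono-≤ (pendants-covered≤1 M isM P c Pc onlyC) (≤-reflexive (count-eqb a))))
      where
      Pc : P c ≡ false
      Pc rewrite c∈K = refl
      onlyC : ∀ q → P q ≡ true → ∀ b → Adj G q b → b ≡ c
      onlyC q pq = proj₂ (pendant q (not-true (∧-true₁ pq)) (eqb-false (not-true (∧-true₂ pq))))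
      pendantOrA : ∀ v → memb (ends M) v ∧ not (K v) ≡ true → (memb (ends M) v ∧ P v) ∨ eqb v a ≡ true
      pendantOrA v p with v ≟F a
      ... | yes e = ∨-zeroʳ _
      ... | no ne = trans (∨-identityʳ _) (∧-intro (∧-true₁ {memb (ends M) v} p) (∧-intro (∧-true₂ {memb (ends M) v} p) refl))
    outsideNeighbour : ∀ w → K w ≡ true → Σ (Fin n) λ x → K x ≡ false × Adj G w x
    outsideNeighbour w kw with w ≟F c
    ... | no w≢c = a , a∉K , Adj-sym (a~K w kw w≢c)
    ... | yes refl with count-witness P (λ e → 2≰0 (subst (2 ≤_) e pendants≥2))
      where 2≰0 : ¬ (2 ≤ 0)
            2≰0 ()
    ... | q , pq = q , not-true (∧-true₁ pq) , Adj-sym (proj₁ (pendant q (not-true (∧-true₁ pq)) (eqb-false (not-true (∧-true₂ pq)))))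
    equimatchable : Equimatchable G
    equimatchable = equimatchable-by (suc (count K)) λ M maxM →
      SplitMatchingSize.size-odd K clique M maxM oddK (matchedOutside≤2 M (proj₁ maxM)) outsideNeighbour

  cliquePlusPair-equimatchable-split : CliquePlusPair → Equimatchable G × IsSplit G
  cliquePlusPair-equimatchable-split (cliquePlusPair oddN x y x≢y x≁y dominated cliqueRest) =
    equimatchable , (C , clique , independent)
    where
    C : Fin n → Bool
    C v = not (eqb v x) ∧ not (eqb v y)
    ≢x : ∀ {u} → C u ≡ true → u ≢ x
    ≢x p = eqb-false (not-true (∧-true₁ p))
    ≢y : ∀ {u} → C u ≡ true → u ≢ y
    ≢y p = eqb-false (not-true (∧-true₂ p))
    clique : Clique C
    clique u v ne cu cv = cliqueRest u v ne (≢x cu) (≢y cu) (≢x cv) (≢y cv)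
    outside : ∀ u → C u ≡ false → u ≡ x ⊎ u ≡ y
    outside u p = decide (u ≟F x) (u ≟F y)
      where decide : Dec (u ≡ x) → Dec (u ≡ y) → u ≡ x ⊎ u ≡ y
            decide (yes e) _ = inj₁ e
            decide (no _) (yes e) = inj₂ e
            decide (no a) (no b) = ⊥-elim (true≢false (trans (sym (∧-intro (not-false (eqb-≢ a)) (not-false (eqb-≢ b)))) p))
    independent : IndependentRest C
    independent u v cu cv uv with outside u cu | outside v cv
    ... | inj₁ refl | inj₁ refl = Adj⇒≢ uv refl
    ... | inj₂ refl | inj₂ refl = Adj⇒≢ uv refl
    ... | inj₁ refl | inj₂ refl = x≁y uv
    ... | inj₂ refl | inj₁ refl = x≁y (Adj-sym uv)
    oddC : parity (count C) ≡ 1ℙ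
    oddC = trans (cong parity (count-allBut2 x y x≢y)) oddN
    matchedOutside≤2 : ∀ M → count (λ v → memb (ends M) v ∧ not (C v)) ≤ 2
    matchedOutside≤2 M = ≤-trans (count-mono _ (λ v → eqb v x ∨ eqb v y) isXorY)
      (≤-trans (count-∨-≤ (λ v → eqb v x) (λ v → eqb v y)) (≤-reflexive (cong₂ _+_ (count-eqb x) (count-eqb y))))
      where
      isXorY : ∀ v → memb (ends M) v ∧ not (C v) ≡ true → eqb v x ∨ eqb v y ≡ true
      isXorY v p with outside v (not-true (∧-true₂ p))
      ... | inj₁ refl = cong (_∨ eqb x y) (eqb-refl x)
      ... | inj₂ refl = trans (cong (eqb y x ∨_) (eqb-refl y)) (∨-zeroʳ _)
    outsideNeighbour : ∀ w → C w ≡ true → Σ (Fin n) λ v → C v ≡ false × Adj G w v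
    outsideNeighbour w cw with dominated w (≢x cw) (≢y cw)
    ... | inj₁ wx = x , cong (λ t → not t ∧ not (eqb x y)) (eqb-refl x) , wx
    ... | inj₂ wy = y , trans (cong (λ t → not (eqb y x) ∧ not t) (eqb-refl y)) (∧-zeroʳ _) , wy
    equimatchable : Equimatchable G
    equimatchable = equimatchable-by (suc (count C)) λ M maxM →
      SplitMatchingSize.size-odd C clique M maxM oddC (matchedOutside≤2 M) outsideNeighbour

  another-vertex : 2 ≤ n → (z : Fin n) → Σ (Fin n) λ u → u ≢ z
  another-vertex 2≤n z with count-witness (λ u → not (eqb u z)) (λ e → n≢1 (trans (sym (count-allBut z)) (cong suc e)))
    where n≢1 : n ≢ 1
          n≢1 refl = 2≰1 2≤n
            where 2≰1 : ¬ (2 ≤ 1)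
                  2≰1 (s≤s ())
  ... | u , q = u , eqb-false (not-true q)

  shape⇒equimatchable-split : 2 ≤ n → Shape → Equimatchable G × IsSplit G
  shape⇒equimatchable-split _ (inj₁ complete) = complete-equimatchable-split complete
  shape⇒equimatchable-split 2≤n (inj₂ (inj₁ s)) = star-equimatchable-split s (another-vertex 2≤n (Star.z s))
  shape⇒equimatchable-split _ (inj₂ (inj₂ (inj₁ P))) = pendantClique-equimatchable-split P
  shape⇒equimatchable-split _ (inj₂ (inj₂ (inj₂ (inj₁ H)))) = hubClique-equimatchable-split H
  shape⇒equimatchable-split _ (inj₂ (inj₂ (inj₂ (inj₂ Q)))) = cliquePlusPair-equimatchable-split Q

module DegreeConditions (m : ℕ) (G : Graph (suc (suc (suc (suc m))))) where

  open import Data.Nat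
  open import Data.Nat.Properties
  open import Data.Bool using (Bool; true; false; _∧_; _∨_; not)
  open import Data.Bool.Properties using (not-involutive; ∧-zeroʳ; ∧-identityʳ; ∨-zeroʳ)
  open import Data.Fin.Properties using () renaming (_≟_ to _≟F_)
  open import Data.Product
  open import Data.Sum
  open import Data.Empty
  open import Relation.Nullary
  open import Relation.Binary.PropositionalEquality
  open Graph G using (adj; irrefl)
  open import Data.Parity.Base using (_⁻¹)
  open Counting
  open GraphBasics G
  open Degrees G
  open Shapes G

  N : ℕ
  N = suc (suc (suc (suc m)))

  r p : ℕ
  r = numDeg G 1
  p = numDeg G (N ∸ 1)

  AllUniversal StarDegrees PendantCliqueDegrees HubCliqueDegrees PairDegrees : Set
  AllUniversal = p ≡ N
  StarDegrees = r ≡ N ∸ 1 × p ≡ 1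
  PendantCliqueDegrees = p ≡ 1 × 2 ≤ r × 2 ∣ (N ∸ r) ×
    (∀ v → d v ≡ 1 ⊎ d v ≡ N ∸ r ∸ 1 ⊎ d v ≡ N ∸ 1)
  HubCliqueDegrees = p ≡ 0 × 2 ≤ r × 2 ∣ (N ∸ r) ×
    Σ (Fin N) λ x → Σ (Fin N) λ y → x ≢ y × ¬ Adj G x y ×
      d x ≡ N ∸ 2 × d y ≡ N ∸ r ∸ 2 ×
      (∀ v → v ≢ x → v ≢ y → d v ≡ 1 ⊎ d v ≡ N ∸ r ∸ 1)
  PairDegrees = ¬ 2 ∣ N ×
    Σ (Fin N) λ x → Σ (Fin N) λ y → x ≢ y ×
      d x + d y ≡ p + N ∸ 2 ×
      (∀ v → v ≢ x → v ≢ y → d v ≡ N ∸ 1 ⊎ d v ≡ N ∸ 2)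

  Conditions : Set
  Conditions = AllUniversal ⊎ StarDegrees ⊎ PendantCliqueDegrees ⊎ HubCliqueDegrees ⊎ PairDegrees

  universal : ∀ v → d v ≡ N ∸ 1 → ∀ w → w ≢ v → Adj G v w
  universal v e = deg⇒universal v e (s≤s z≤n)

  isUniversal : Fin N → Bool
  isUniversal = hasDeg (N ∸ 1)

  isLeaf : Fin N → Bool
  isLeaf = hasDeg 1

  N∸1≢1 : N ∸ 1 ≢ 1
  N∸1≢1 ()

  N∸2≢1 : N ∸ 2 ≢ 1
  N∸2≢1 ()

  ≥2⇒≢1 : ∀ {x} → 2 ≤ x → x ≢ 1
  ≥2⇒≢1 (s≤s ()) refl

  sum∸ : ∀ a b → a + b ≡ N → N ∸ b ≡ a
  sum∸ a b e = trans (cong (_∸ b) (sym e)) (m+n∸n≡m a b)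

  unique-universal : p ≡ 1 → Σ (Fin N) λ z → d z ≡ N ∸ 1 × (∀ v → d v ≡ N ∸ 1 → v ≡ z)
  unique-universal e with count-witness isUniversal (λ q → 1≢0 (trans (sym e) (trans (numDeg≡count (N ∸ 1)) q)))
    where 1≢0 : 1 ≢ 0
          1≢0 ()
  ... | z , uz = z , does-≟ uz , λ v dv → count-one isUniversal (trans (sym (numDeg≡count (N ∸ 1))) e) v z (hasDeg-true dv) uz

  complete⇒allUniversal : Complete → AllUniversal
  complete⇒allUniversal complete =
    trans (numDeg-by (N ∸ 1) (λ _ → true) (λ v _ → universal⇒deg v (λ w ne → complete v w (λ e → ne (sym e)))) (λ v ()))
          (count-all _ (λ _ → refl))

  allUniversal⇒complete : AllUniversal → Complete
  allUniversal⇒complete e u v ne = universal u (does-≟ everyUniversal) v (λ e → ne (sym e))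
    where everyUniversal : isUniversal u ≡ true
          everyUniversal = count-saturate isUniversal (λ _ → true) (λ _ _ → refl)
            (≤-reflexive (trans (count-all (λ _ → true) (λ _ → refl)) (sym (trans (sym (numDeg≡count (N ∸ 1))) e)))) u refl

  star⇒starDegrees : Star → StarDegrees
  star⇒starDegrees (star z centre leaves) =
    trans (numDeg-by 1 (λ v → not (eqb v z)) (λ v q → leafDeg v (eqb-false (not-true q))) centreNotLeaf)
          (suc-injective (count-allBut z)) ,
    trans (numDeg-by (N ∸ 1) (λ v → eqb v z) (λ v q → subst (λ t → d t ≡ N ∸ 1) (sym (eqb-≡ q)) centreDeg)
            (λ v q e → N∸1≢1 (trans (sym e) (leafDeg v (eqb-false q)))))
          (count-eqb z)
    where
    leafDeg : ∀ v → v ≢ z → d v ≡ 1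
    leafDeg v v≢z = trans (deg-by v (λ u → eqb u z) nbhd) (count-eqb z)
      where nbhd : ∀ u → adj v u ≡ eqb u z
            nbhd u with u ≟F z
            ... | yes refl = Adj-sym (centre v v≢z)
            ... | no ne = ¬Adj⇒false (leaves v u v≢z ne)
    centreDeg : d z ≡ N ∸ 1
    centreDeg = universal⇒deg z centre
    centreNotLeaf : ∀ v → not (eqb v z) ≡ false → d v ≢ 1
    centreNotLeaf v q e with eqb-≡ {i = v} {j = z} (trans (sym (not-involutive _)) (cong not q))
    ... | refl = N∸1≢1 (trans (sym centreDeg) e)

  starDegrees⇒star : StarDegrees → Star
  starDegrees⇒star (r≡N∸1 , p≡1) with unique-universal p≡1
  ... | z , dz , onlyZ = star z (λ u ne → universal z dz u ne) leavesIndependent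
    where
    leaf : ∀ v → v ≢ z → d v ≡ 1
    leaf v ne = does-≟ (count-saturate isLeaf (λ u → not (eqb u z))
      (λ u q → not-false (eqb-≢ {i = u} {j = z} λ { refl → N∸1≢1 (trans (sym dz) (does-≟ q)) }))
      (≤-reflexive (trans (suc-injective (count-allBut z)) (trans (sym r≡N∸1) (numDeg≡count 1)))) v (not-false (eqb-≢ ne)))
    leavesIndependent : ∀ u v → u ≢ z → v ≢ z → ¬ Adj G u v
    leavesIndependent u v uz vz uv = vz (deg1-neighbour u v z (leaf u uz) uv (Adj-sym (universal z dz u uz)))

  degree-sum : ∀ x y → d x + d y ≡ count (λ u → adj x u ∨ adj y u) + count (λ u → adj x u ∧ adj y u)
  degree-sum x y = trans (cong₂ _+_ (deg≡count x) (deg≡count y)) (sym (count-∨ (adj x) (adj y)))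

  union-nbhd : ∀ x y → x ≢ y → ¬ Adj G x y → (∀ w → w ≢ x → w ≢ y → Adj G w x ⊎ Adj G w y) →
    count (λ u → adj x u ∨ adj y u) ≡ N ∸ 2
  union-nbhd x y x≢y x≁y dominated = cong (_∸ 2) (trans (cong (suc ∘′ suc) (count-ext allOthers)) (count-allBut2 x y x≢y))
    where
    open import Function using (_∘′_)
    allOthers : ∀ u → adj x u ∨ adj y u ≡ not (eqb u x) ∧ not (eqb u y)
    allOthers u with u ≟F x | u ≟F y
    ... | yes refl | _ = trans (cong (_∨ adj y x) (irrefl x)) (¬Adj⇒false (λ a → x≁y (Adj-sym a)))
    ... | no _ | yes refl = trans (cong (_∨ adj y y) (¬Adj⇒false x≁y)) (irrefl y)
    ... | no a | no b with dominated u a b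
    ... | inj₁ q = cong (_∨ adj y u) (Adj-sym q)
    ... | inj₂ q = trans (cong (adj x u ∨_) (Adj-sym q)) (∨-zeroʳ _)

  +N∸2 : ∀ q → q + N ∸ 2 ≡ q + (N ∸ 2)
  +N∸2 q = +-∸-assoc q {N} {2} (s≤s (s≤s z≤n))

  -- (v), from the shape: the universal vertices are the common neighbours of x
  -- and y, the union of their neighbourhoods is everything but x and y, and
  -- every other vertex misses at most one of x, y.
  module FromCliquePlusPair (Q : CliquePlusPair) where
    open CliquePlusPair Q renaming (clique to cliqueRest)

    universalOther : ∀ w → w ≢ x → w ≢ y → Adj G w x → Adj G w y → ∀ u → u ≢ w → Adj G w u
    universalOther w wx wy wx' wy' u uw with u ≟F x | u ≟F y
    ... | yes refl | _ = wx'
    ... | no _ | yes refl = wy'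
    ... | no a | no b = cliqueRest w u (λ e → uw (sym e)) wx wy a b
    otherDeg : ∀ w → w ≢ x → w ≢ y → d w ≡ N ∸ 1 ⊎ d w ≡ N ∸ 2
    otherDeg w wx wy with adj w x in ex | adj w y in ey
    ... | true | true = inj₁ (universal⇒deg w (universalOther w wx wy ex ey))
    ... | false | _ = inj₂ (deg-all-but-one w x (λ e → wx (sym e)) ex nbhd)
      where nbhd : ∀ u → u ≢ w → u ≢ x → Adj G w u
            nbhd u uw ux with u ≟F y
            ... | no uy = cliqueRest w u (λ e → uw (sym e)) wx wy ux uy
            ... | yes refl with dominated w wx wy
            ... | inj₁ q = ⊥-elim (true≢false (trans (sym q) ex))
            ... | inj₂ q = q
    ... | true | false = inj₂ (deg-all-but-one w y (λ e → wy (sym e)) ey nbhd)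
      where nbhd : ∀ u → u ≢ w → u ≢ y → Adj G w u
            nbhd u uw uy with u ≟F x
            ... | yes refl = ex
            ... | no ux = cliqueRest w u (λ e → uw (sym e)) wx wy ux uy
    commonNbhd : p ≡ count (λ u → adj x u ∧ adj y u)
    commonNbhd = numDeg-by (N ∸ 1) (λ u → adj x u ∧ adj y u) common⇒universal universal⇒common
      where
      common⇒universal : ∀ u → adj x u ∧ adj y u ≡ true → d u ≡ N ∸ 1
      common⇒universal u q = universal⇒deg u (universalOther u (λ e → Adj⇒≢ (∧-true₁ q) (sym e))
        (λ e → Adj⇒≢ (∧-true₂ {adj x u} q) (sym e)) (Adj-sym (∧-true₁ q)) (Adj-sym (∧-true₂ {adj x u} q)))
      universal⇒common : ∀ u → adj x u ∧ adj y u ≡ false → d u ≢ N ∸ 1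
      universal⇒common u q with u ≟F x | u ≟F y
      ... | yes refl | _ = non-universal x y (λ e → x≢y (sym e)) x≁y
      ... | no _ | yes refl = non-universal y x x≢y (λ a → x≁y (Adj-sym a))
      ... | no ux | no uy with adj x u in ea
      ... | false = non-universal u x (λ e → ux (sym e)) (λ a → true≢false (trans (sym (Adj-sym a)) ea))
      ... | true = non-universal u y (λ e → uy (sym e)) (λ a → true≢false (trans (sym (Adj-sym a)) q))
    sumEq : d x + d y ≡ p + N ∸ 2
    sumEq = begin
        d x + d y                                 ≡⟨ degree-sum x y ⟩
        count (λ u → adj x u ∨ adj y u) + count (λ u → adj x u ∧ adj y u) ≡⟨ cong₂ _+_ (union-nbhd x y x≢y x≁y dominated) (sym commonNbhd) ⟩
        (N ∸ 2) + p                               ≡⟨ +-comm (N ∸ 2) p ⟩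
        p + (N ∸ 2)                               ≡⟨ sym (+N∸2 p) ⟩
        p + N ∸ 2                                 ∎
      where open ≡-Reasoning

    degrees : PairDegrees
    degrees = (λ 2∣N → 0ℙ≢1ℙ (trans (sym (2∣⇒even N 2∣N)) oddN)) , x , y , x≢y , sumEq , otherDeg

  module FromPairDegrees (x y : Fin N) (x≢y : x ≢ y) (sumEq : d x + d y ≡ p + N ∸ 2)
                         (otherDeg : ∀ v → v ≢ x → v ≢ y → d v ≡ N ∸ 1 ⊎ d v ≡ N ∸ 2) where

    one-miss-only : ∀ w → w ≢ x → w ≢ y → ∀ u1 u2 → u1 ≢ w → u2 ≢ w → u1 ≢ u2 →
      adj w u1 ≡ false → adj w u2 ≡ false → ⊥
    one-miss-only w wx wy u1 u2 n1 n2 n12 a1 a2 with deg-two-misses w u1 u2 n1 n2 n12 a1 a2 | otherDeg w wx wy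
    ... | le | inj₁ e = 1+n≰n (≤-trans (s≤s (s≤s (s≤s (≤-reflexive (sym e))))) (≤-trans le (n≤1+n N)))
    ... | le | inj₂ e = 1+n≰n (≤-trans (s≤s (s≤s (s≤s (≤-reflexive (sym e))))) le)

    adjacent-to-x-or-y : ∀ w → w ≢ x → w ≢ y → adj w x ≡ true ⊎ adj w y ≡ true
    adjacent-to-x-or-y w wx wy with adj w x in e1 | adj w y in e2
    ... | true | _ = inj₁ refl
    ... | false | true = inj₂ refl
    ... | false | false = ⊥-elim (one-miss-only w wx wy x y (λ e → wx (sym e)) (λ e → wy (sym e)) x≢y e1 e2)

    union+common : count (λ u → adj x u ∨ adj y u) + count (λ u → adj x u ∧ adj y u) ≡ p + (N ∸ 2)
    union+common = trans (sym (degree-sum x y)) (trans sumEq (+N∸2 p))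

    -- x ~ y: then x and y are universal, hence so is everyone.
    module Adjacent (xy : Adj G x y) where
      A B : Fin N → Bool
      A = adj x
      B = adj y
      unionAll : count (λ u → A u ∨ B u) ≡ N
      unionAll = count-all _ inUnion
        where inUnion : ∀ u → A u ∨ B u ≡ true
              inUnion u with u ≟F x | u ≟F y
              ... | yes refl | _ = trans (cong (A x ∨_) (Adj-sym xy)) (∨-zeroʳ _)
              ... | no _ | yes refl = cong (_∨ B y) xy
              ... | no a | no b with adjacent-to-x-or-y u a b
              ... | inj₁ q = cong (_∨ B u) (Adj-sym q)
              ... | inj₂ q = trans (cong (A u ∨_) (Adj-sym q)) (∨-zeroʳ _)
      p≡2+common : p ≡ suc (suc (count (λ u → A u ∧ B u)))
      p≡2+common = +-cancelʳ-≡ (N ∸ 2) p _ (trans (sym union+common)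
        (trans (cong (_+ count (λ u → A u ∧ B u)) unionAll) (cong (suc ∘′ suc) (+-comm (N ∸ 2) _))))
        where open import Function using (_∘′_)
      -- Every universal vertex is x, y or a common neighbour; there are no more
      -- such vertices than universal ones, so all of them are universal.
      S : Fin N → Bool
      S u = (A u ∧ B u) ∨ (eqb u x ∨ eqb u y)
      universal⇒S : ∀ u → isUniversal u ≡ true → S u ≡ true
      universal⇒S u fu with u ≟F x | u ≟F y
      ... | yes refl | _ = ∨-zeroʳ _
      ... | no _ | yes refl = ∨-zeroʳ _
      ... | no a | no b = cong (_∨ false) (∧-intro (Adj-sym (universal u (does-≟ fu) x (λ e → a (sym e))))
                                                   (Adj-sym (universal u (does-≟ fu) y (λ e → b (sym e)))))
      S≤p : count S ≤ count isUniversal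
      S≤p = ≤-trans (count-∨-≤ (λ u → A u ∧ B u) (λ u → eqb u x ∨ eqb u y))
              (≤-trans (+-monoʳ-≤ (count (λ u → A u ∧ B u)) (≤-trans (count-∨-≤ (λ u → eqb u x) (λ u → eqb u y))
                  (≤-reflexive (cong₂ _+_ (count-eqb x) (count-eqb y)))))
                (≤-reflexive (trans (+-comm _ 2) (trans (sym p≡2+common) (numDeg≡count (N ∸ 1))))))
      S⇒universal : ∀ u → S u ≡ true → isUniversal u ≡ true
      S⇒universal = count-saturate isUniversal S universal⇒S S≤p
      xUniversal : d x ≡ N ∸ 1
      xUniversal = does-≟ (S⇒universal x (trans (cong (λ t → (A x ∧ B x) ∨ (t ∨ eqb x y)) (eqb-refl x)) (∨-zeroʳ _)))
      yUniversal : d y ≡ N ∸ 1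
      yUniversal = does-≟ (S⇒universal y (trans (cong (λ t → (A y ∧ B y) ∨ (eqb y x ∨ t)) (eqb-refl y))
        (trans (cong ((A y ∧ B y) ∨_) (∨-zeroʳ (eqb y x))) (∨-zeroʳ (A y ∧ B y)))))
      everyoneUniversal : ∀ u → d u ≡ N ∸ 1
      everyoneUniversal u with u ≟F x | u ≟F y
      ... | yes refl | _ = xUniversal
      ... | no _ | yes refl = yUniversal
      ... | no a | no b = does-≟ (S⇒universal u (cong (_∨ (eqb u x ∨ eqb u y))
              (∧-intro (universal x xUniversal u a) (universal y yUniversal u b))))

    adjacent⇒complete : Adj G x y → Complete
    adjacent⇒complete xy u v ne = universal u (everyoneUniversal u) v (λ e → ne (sym e))
      where open Adjacent xy

    -- x ≁ y: the universal vertices are exactly the common neighbours, so two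
    -- other vertices are adjacent (else one of them misses two vertices or is
    -- a non-universal common neighbour).
    nonadjacent⇒cliquePlusPair : parity N ≡ 1ℙ → ¬ Adj G x y → CliquePlusPair
    nonadjacent⇒cliquePlusPair oddN x≁y =
      cliquePlusPair oddN x y x≢y x≁y adjacent-to-x-or-y cliqueRest
      where
      A B : Fin N → Bool
      A = adj x
      B = adj y
      p≡common : p ≡ count (λ u → A u ∧ B u)
      p≡common = sym (+-cancelˡ-≡ (N ∸ 2) _ _
        (trans (cong (_+ count (λ u → A u ∧ B u)) (sym (union-nbhd x y x≢y x≁y adjacent-to-x-or-y))) (trans union+common (+-comm p _))))
      universal⇒common : ∀ u → isUniversal u ≡ true → A u ∧ B u ≡ true
      universal⇒common u fu with u ≟F x | u ≟F y
      ... | yes refl | _ = ⊥-elim (non-universal x y (λ e → x≢y (sym e)) x≁y (does-≟ fu))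
      ... | no _ | yes refl = ⊥-elim (non-universal y x x≢y (λ a → x≁y (Adj-sym a)) (does-≟ fu))
      ... | no a | no b = ∧-intro (Adj-sym (universal u (does-≟ fu) x (λ e → a (sym e))))
                                  (Adj-sym (universal u (does-≟ fu) y (λ e → b (sym e))))
      common⇒universal : ∀ u → A u ∧ B u ≡ true → isUniversal u ≡ true
      common⇒universal = count-saturate isUniversal (λ u → A u ∧ B u) universal⇒common
        (≤-reflexive (trans (sym p≡common) (numDeg≡count (N ∸ 1))))
      cliqueRest : ∀ u v → u ≢ v → u ≢ x → u ≢ y → v ≢ x → v ≢ y → Adj G u v
      cliqueRest u v uv ux uy vx vy with adj u v in euv
      ... | true = refl
      ... | false with adj u x in eux
      ... | false = ⊥-elim (one-miss-only u ux uy x v (λ e → ux (sym e)) (λ e → uv (sym e)) (λ e → vx (sym e)) eux euv)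
      ... | true with adj u y in euy
      ... | false = ⊥-elim (one-miss-only u ux uy y v (λ e → uy (sym e)) (λ e → uv (sym e)) (λ e → vy (sym e)) euy euv)
      ... | true = ⊥-elim (true≢false (trans (sym (universal u (does-≟ (common⇒universal u
                    (∧-intro (Adj-sym eux) (Adj-sym euy)))) v (λ e → uv (sym e)))) euv))

  pairDegrees⇒shape : PairDegrees → CliquePlusPair ⊎ Complete
  pairDegrees⇒shape (N-odd , x , y , x≢y , sumEq , otherDeg) with adj x y in exy
  ... | true = inj₂ (adjacent⇒complete exy)
    where open FromPairDegrees x y x≢y sumEq otherDeg
  ... | false = inj₁ (nonadjacent⇒cliquePlusPair oddN (false⇒¬Adj exy))
    where
    open FromPairDegrees x y x≢y sumEq otherDeg
    oddN : parity N ≡ 1ℙ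
    oddN with parity N in e
    ... | 1ℙ = refl
    ... | 0ℙ = ⊥-elim (N-odd (even⇒2∣ N e))

  -- (iii), from the shape: the pendants have degree 1, z is universal, and
  -- the other clique vertices have degree |C| - 1 = n - r - 1.
  module FromPendantClique (P : PendantClique) where
    open PendantClique P

    pendants : ℕ
    pendants = count (λ v → not (C v))

    z-universal : d z ≡ N ∸ 1
    z-universal = universal⇒deg z adjacentToZ
      where adjacentToZ : ∀ w → w ≢ z → Adj G z w
            adjacentToZ w ne with C w in cw
            ... | true = clique z w (λ e → ne (sym e)) z∈C cw
            ... | false = Adj-sym (proj₁ (pendant w cw))

    clique-deg : ∀ v → C v ≡ true → v ≢ z → suc (d v) ≡ count C
    clique-deg v cv v≢z = trans (cong suc (deg-by v (λ u → C u ∧ not (eqb u v)) nbhd)) (sym (count-remove C v cv))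
      where nbhd : ∀ u → adj v u ≡ C u ∧ not (eqb u v)
            nbhd u with C u in cu
            ... | false = ¬Adj⇒false (λ vu → v≢z (proj₂ (pendant u cu) v (Adj-sym vu)))
            ... | true with u ≟F v
            ... | yes refl = irrefl u
            ... | no ne = clique v u (λ e → ne (sym e)) cv cu

    pendant-deg : ∀ a → C a ≡ false → d a ≡ 1
    pendant-deg a ca = trans (deg-by a (λ u → eqb u z) nbhd) (count-eqb z)
      where nbhd : ∀ u → adj a u ≡ eqb u z
            nbhd u with u ≟F z
            ... | yes refl = proj₁ (pendant a ca)
            ... | no ne = ¬Adj⇒false (λ au → ne (proj₂ (pendant a ca) u au))

    r≡pendants : r ≡ pendants
    r≡pendants = numDeg-by 1 (λ v → not (C v)) (λ v q → pendant-deg v (not-true q)) cliqueNotLeaf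
      where cliqueNotLeaf : ∀ v → not (C v) ≡ false → d v ≢ 1
            cliqueNotLeaf v q with v ≟F z
            ... | yes refl = λ e → N∸1≢1 (trans (sym z-universal) e)
            ... | no ne = ≥2⇒≢1 (≤-trans (s≤s (s≤s (z≤n {1})))
                    (≤-pred (subst (4 ≤_) (sym (clique-deg v (trans (sym (not-involutive _)) (cong not q)) ne)) C≥4)))

    p≡1 : p ≡ 1
    p≡1 = trans (numDeg-by (N ∸ 1) (λ v → eqb v z) (λ v q → subst (λ t → d t ≡ N ∸ 1) (sym (eqb-≡ q)) z-universal) onlyZ)
                (count-eqb z)
      where
      somePendant : Σ (Fin N) λ a → C a ≡ false
      somePendant with count-witness (λ v → not (C v)) (λ e → 2≰0 (subst (2 ≤_) e pendants≥2))
        where 2≰0 : ¬ (2 ≤ 0)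
              2≰0 ()
      ... | a , q = a , not-true q
      onlyZ : ∀ v → eqb v z ≡ false → d v ≢ N ∸ 1
      onlyZ v q with C v in cv
      ... | false = λ e → N∸1≢1 (trans (sym e) (pendant-deg v cv))
      ... | true = non-universal v (proj₁ somePendant) (λ { refl → true≢false (trans (sym cv) (proj₂ somePendant)) })
                     (λ va → eqb-false q (proj₂ (pendant (proj₁ somePendant) (proj₂ somePendant)) v (Adj-sym va)))

    N∸r≡C : N ∸ r ≡ count C
    N∸r≡C = trans (cong (N ∸_) r≡pendants) (sum∸ (count C) pendants (count-complement C))

    degrees : PendantCliqueDegrees
    degrees = p≡1 , subst (2 ≤_) (sym r≡pendants) pendants≥2 , subst (2 ∣_) (sym N∸r≡C) (even⇒2∣ (count C) evenC) , threeDegrees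
      where
      threeDegrees : ∀ v → d v ≡ 1 ⊎ d v ≡ N ∸ r ∸ 1 ⊎ d v ≡ N ∸ 1
      threeDegrees v with C v in cv
      ... | false = inj₁ (pendant-deg v cv)
      ... | true with v ≟F z
      ... | yes refl = inj₂ (inj₂ z-universal)
      ... | no ne = inj₂ (inj₁ (trans (cong pred (clique-deg v cv ne)) (cong (_∸ 1) (sym N∸r≡C))))

  -- (iii), towards the shape: the clique is formed by the non-leaves; the
  -- unique universal vertex z carries all the leaves.
  module FromPendantCliqueDegrees (p≡1 : p ≡ 1) (r≥2 : 2 ≤ r) (2∣N∸r : 2 ∣ (N ∸ r))
      (threeDegrees : ∀ v → d v ≡ 1 ⊎ d v ≡ N ∸ r ∸ 1 ⊎ d v ≡ N ∸ 1) where

    z : Fin N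
    z = proj₁ (unique-universal p≡1)
    dz : d z ≡ N ∸ 1
    dz = proj₁ (proj₂ (unique-universal p≡1))
    onlyZ : ∀ v → d v ≡ N ∸ 1 → v ≡ z
    onlyZ = proj₂ (proj₂ (unique-universal p≡1))

    C : Fin N → Bool
    C v = not (isLeaf v)
    C⇒not-leaf : ∀ {v} → C v ≡ true → d v ≢ 1
    C⇒not-leaf q e = true≢false (trans (sym (hasDeg-true e)) (not-true q))
    leaf : ∀ {v} → C v ≡ false → d v ≡ 1
    leaf q = does-≟ (trans (sym (not-involutive _)) (cong not q))
    z∈C : C z ≡ true
    z∈C = not-false (hasDeg-false (λ e → N∸1≢1 (trans (sym dz) e)))
    pendant : ∀ a → C a ≡ false → Adj G a z × (∀ b → Adj G a b → b ≡ z)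
    pendant a q = Adj-sym (universal z dz a a≢z) , λ b ab → deg1-neighbour a b z (leaf q) ab (Adj-sym (universal z dz a a≢z))
      where a≢z : a ≢ z
            a≢z refl = true≢false (trans (sym z∈C) q)
    C≡N∸r : count C ≡ N ∸ r
    C≡N∸r = sym (sum∸ (count C) r (trans (+-comm (count C) r) (trans (cong (_+ count C) (numDeg≡count 1)) (count-complement isLeaf))))
    evenC : parity (count C) ≡ 0ℙ
    evenC = trans (cong parity C≡N∸r) (2∣⇒even _ 2∣N∸r)
    pendants≥2 : 2 ≤ count (λ v → not (C v))
    pendants≥2 = subst (2 ≤_) (trans (numDeg≡count 1) (count-ext (λ v → sym (not-involutive (isLeaf v))))) r≥2
    cliqueDeg : ∀ u → C u ≡ true → u ≢ z → d u ≡ N ∸ r ∸ 1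
    cliqueDeg u cu u≢z with threeDegrees u
    ... | inj₁ e = ⊥-elim (C⇒not-leaf cu e)
    ... | inj₂ (inj₁ e) = e
    ... | inj₂ (inj₂ e) = ⊥-elim (u≢z (onlyZ u e))
    -- A clique vertex u ≠ z has all its neighbours in C ∖ {u}, and exactly |C| - 1 of them.
    clique : GraphBasics.Clique G C
    clique u v uv cu cv with u ≟F z | v ≟F z
    ... | yes refl | _ = universal z dz v (λ e → uv (sym e))
    ... | no _ | yes refl = Adj-sym (universal z dz u uv)
    ... | no u≢z | no _ = nbhd-saturated u (λ w → C w ∧ not (eqb w u)) nbhd⊆ size v
                            (∧-intro cv (not-false (eqb-≢ (λ e → uv (sym e)))))
      where
      nbhd⊆ : ∀ w → Adj G u w → C w ∧ not (eqb w u) ≡ true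
      nbhd⊆ w uw with C w in cw
      ... | false = ⊥-elim (u≢z (proj₂ (pendant w cw) u (Adj-sym uw)))
      ... | true = not-false (eqb-≢ (λ e → Adj⇒≢ uw (sym e)))
      size : count (λ w → C w ∧ not (eqb w u)) ≤ d u
      size = ≤-reflexive (trans (cong pred (sym (count-remove C u cu))) (trans (cong pred C≡N∸r) (sym (cliqueDeg u cu u≢z))))
    -- |C| = 2 would make the other clique vertex a leaf.
    C≥4 : 4 ≤ count C
    C≥4 = even-≥4 (count C) evenC (count-pos C z z∈C) C≢2
      where
      C≢2 : count C ≢ 2
      C≢2 e with count-witness (λ v → C v ∧ not (eqb v z))
                   (λ e0 → 2≢1 (trans (sym e) (trans (count-remove C z z∈C) (cong suc e0))))
        where 2≢1 : 2 ≢ 1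
              2≢1 ()
      ... | w , q = C⇒not-leaf (∧-true₁ q)
                      (trans (cliqueDeg w (∧-true₁ q) (eqb-false (not-true (∧-true₂ q)))) (cong (_∸ 1) (trans (sym C≡N∸r) e)))

    shape : PendantClique
    shape = pendantClique C z z∈C clique pendant evenC C≥4 pendants≥2

  pendantCliqueDegrees⇒shape : PendantCliqueDegrees → PendantClique
  pendantCliqueDegrees⇒shape (p≡1 , r≥2 , 2∣N∸r , threeDegrees) =
    FromPendantCliqueDegrees.shape p≡1 r≥2 2∣N∸r threeDegrees

  -- (iv), from the shape: c has degree n - 2, a has degree |K| - 1, the other
  -- clique vertices |K| and the pendants 1; n - r = |K| + 1; nobody is universal.
  module FromHubClique (H : HubClique) where
    open HubClique H

    isPendant : Fin N → Bool
    isPendant v = not (K v) ∧ not (eqb v a)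

    pendants : ℕ
    pendants = count isPendant

    K≢out : ∀ {u v} → K u ≡ true → K v ≡ false → u ≢ v
    K≢out p q refl = true≢false (trans (sym p) q)

    c≢a : c ≢ a
    c≢a = K≢out c∈K a∉K

    N≡K+1+pendants : suc (count K) + pendants ≡ N
    N≡K+1+pendants = trans (sym (+-suc (count K) pendants))
      (trans (cong (count K +_) (sym (count-remove (λ v → not (K v)) a (not-false a∉K)))) (count-complement K))

    K≥3 : 3 ≤ count K
    K≥3 = odd-≥3 (count K) oddK (count-two K c (proj₁ K-nontrivial) (λ e → proj₂ (proj₂ K-nontrivial) (sym e))
                                            c∈K (proj₁ (proj₂ K-nontrivial)))

    pendant' : ∀ {q} → isPendant q ≡ true → Adj G q c × (∀ b → Adj G q b → b ≡ c)
    pendant' pq = pendant _ (not-true (∧-true₁ pq)) (eqb-false (not-true (∧-true₂ pq)))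

    c-deg : d c ≡ N ∸ 2
    c-deg = deg-all-but-one c a (λ e → c≢a (sym e)) (¬Adj⇒false (λ q → a≁c (Adj-sym q))) nbhd
      where nbhd : ∀ u → u ≢ c → u ≢ a → Adj G c u
            nbhd u uc ua with K u in ku
            ... | true = clique c u (λ e → uc (sym e)) c∈K ku
            ... | false = Adj-sym (proj₁ (pendant u ku ua))

    a-deg : suc (d a) ≡ count K
    a-deg = trans (cong suc (deg-by a (λ u → K u ∧ not (eqb u c)) nbhd)) (sym (count-remove K c c∈K))
      where nbhd : ∀ u → adj a u ≡ K u ∧ not (eqb u c)
            nbhd u with K u in ku
            ... | true with u ≟F c
            ... | yes refl = ¬Adj⇒false a≁c
            ... | no uc = a~K u ku uc
            nbhd u | false with u ≟F a
            ... | yes refl = irrefl u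
            ... | no ua = ¬Adj⇒false (λ au → c≢a (sym (proj₂ (pendant u ku ua) a (Adj-sym au))))

    -- A clique vertex v ≠ c sees K ∖ {v} and a.
    clique-deg : ∀ v → K v ≡ true → v ≢ c → d v ≡ count K
    clique-deg v kv vc = begin
        d v                                                  ≡⟨ deg-by v (λ u → others u ∨ eqb u a) nbhd ⟩
        count (λ u → others u ∨ eqb u a)                     ≡⟨ sym (+-identityʳ _) ⟩
        count (λ u → others u ∨ eqb u a) + 0                 ≡⟨ cong (count (λ u → others u ∨ eqb u a) +_) (sym (count-none _ disjoint)) ⟩
        count (λ u → others u ∨ eqb u a) + count (λ u → others u ∧ eqb u a) ≡⟨ count-∨ others (λ u → eqb u a) ⟩
        count others + count (λ u → eqb u a)                 ≡⟨ cong (count others +_) (count-eqb a) ⟩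
        count others + 1                                     ≡⟨ +-comm _ 1 ⟩
        suc (count others)                                   ≡⟨ sym (count-remove K v kv) ⟩
        count K                                              ∎
      where
      open ≡-Reasoning
      others : Fin N → Bool
      others u = K u ∧ not (eqb u v)
      disjoint : ∀ u → others u ∧ eqb u a ≡ false
      disjoint u with u ≟F a
      ... | no _ = ∧-zeroʳ _
      ... | yes refl rewrite a∉K = refl
      nbhd : ∀ u → adj v u ≡ others u ∨ eqb u a
      nbhd u with K u in ku
      ... | true with u ≟F v
      ... | yes refl = trans (irrefl u) (sym (eqb-≢ (K≢out kv a∉K)))
      ... | no uv = clique v u (λ e → uv (sym e)) kv ku
      nbhd u | false with u ≟F a
      ... | yes refl = Adj-sym (a~K v kv vc)
      ... | no ua = ¬Adj⇒false (λ vu → vc (proj₂ (pendant u ku ua) v (Adj-sym vu)))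

    pendant-deg : ∀ q → isPendant q ≡ true → d q ≡ 1
    pendant-deg q pq = trans (deg-by q (λ u → eqb u c) nbhd) (count-eqb c)
      where nbhd : ∀ u → adj q u ≡ eqb u c
            nbhd u with u ≟F c
            ... | yes refl = proj₁ (pendant' pq)
            ... | no ne = ¬Adj⇒false (λ au → ne (proj₂ (pendant' pq) u au))

    r≡pendants : r ≡ pendants
    r≡pendants = numDeg-by 1 isPendant pendant-deg notLeaf
      where
      K∨a : ∀ v → isPendant v ≡ false → K v ≡ true ⊎ v ≡ a
      K∨a v q with v ≟F a | K v in kv
      ... | yes e | _ = inj₂ e
      ... | no _ | true = inj₁ refl
      ... | no _ | false = ⊥-elim (true≢false q)
      notLeaf : ∀ v → isPendant v ≡ false → d v ≢ 1
      notLeaf v q with K∨a v q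
      ... | inj₂ refl = ≥2⇒≢1 (≤-pred (subst (3 ≤_) (sym a-deg) K≥3))
      ... | inj₁ kv with v ≟F c
      ... | yes refl = λ e → N∸2≢1 (trans (sym c-deg) e)
      ... | no vc = ≥2⇒≢1 (≤-trans (s≤s (s≤s (z≤n {1}))) (subst (3 ≤_) (sym (clique-deg v kv vc)) K≥3))

    p≡0 : p ≡ 0
    p≡0 = trans (numDeg-by (N ∸ 1) (λ _ → false) (λ v ()) (λ v _ → nonUniversal v)) (count-none {N} (λ _ → false) (λ _ → refl))
      where
      somePendant : Σ (Fin N) λ q → isPendant q ≡ true
      somePendant = count-witness isPendant (λ e → 2≰0 (subst (2 ≤_) e pendants≥2))
        where 2≰0 : ¬ (2 ≤ 0)
              2≰0 ()
      q0 : Fin N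
      q0 = proj₁ somePendant
      nonUniversal : ∀ v → d v ≢ N ∸ 1
      nonUniversal v with K v in kv
      ... | true with v ≟F c
      ... | yes refl = non-universal c a (λ e → c≢a (sym e)) (λ q → a≁c (Adj-sym q))
      ... | no vc = non-universal v q0 (λ e → K≢out kv (not-true (∧-true₁ (proj₂ somePendant))) (sym e))
                      (λ vq → vc (proj₂ (pendant' (proj₂ somePendant)) v (Adj-sym vq)))
      nonUniversal v | false with v ≟F a
      ... | yes refl = non-universal a c c≢a a≁c
      ... | no va = non-universal v a (λ e → va (sym e)) (λ va' → c≢a (sym (proj₂ (pendant v kv va) a va')))

    N∸r≡K+1 : N ∸ r ≡ suc (count K)
    N∸r≡K+1 = trans (cong (N ∸_) r≡pendants) (sum∸ (suc (count K)) pendants N≡K+1+pendants)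

    degrees : HubCliqueDegrees
    degrees = p≡0 , subst (2 ≤_) (sym r≡pendants) pendants≥2 ,
              subst (2 ∣_) (sym N∸r≡K+1) (even⇒2∣ (suc (count K)) (trans (parity-suc (count K)) (cong _⁻¹ oddK))) ,
              c , a , c≢a , (λ q → a≁c (Adj-sym q)) , c-deg ,
              trans (cong (_∸ 1) a-deg) (cong (_∸ 2) (sym N∸r≡K+1)) , twoDegrees
      where
      twoDegrees : ∀ v → v ≢ c → v ≢ a → d v ≡ 1 ⊎ d v ≡ N ∸ r ∸ 1
      twoDegrees v vc va with K v in kv
      ... | true = inj₂ (trans (clique-deg v kv vc) (cong (_∸ 1) (sym N∸r≡K+1)))
      ... | false = inj₁ (pendant-deg v (∧-intro (cong not kv) (not-false (eqb-≢ va))))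

  -- The non-leaves other than y form the clique K
  -- with hub x; every leaf hangs at x (x sees everything except y), and y
  -- sees K ∖ {x}.
  module FromHubCliqueDegrees (noIsolated : NoIsolated G) (r≥2 : 2 ≤ r) (2∣N∸r : 2 ∣ (N ∸ r))
      (x y : Fin N) (x≢y : x ≢ y) (x≁y : ¬ Adj G x y) (dx : d x ≡ N ∸ 2) (dy : d y ≡ N ∸ r ∸ 2)
      (twoDegrees : ∀ v → v ≢ x → v ≢ y → d v ≡ 1 ⊎ d v ≡ N ∸ r ∸ 1) where

    s : ℕ
    s = N ∸ r

    nonLeaf : Fin N → Bool
    nonLeaf v = not (isLeaf v)

    nonLeaves≡s : count nonLeaf ≡ s
    nonLeaves≡s = sym (sum∸ (count nonLeaf) r (trans (+-comm (count nonLeaf) r)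
      (trans (cong (_+ count nonLeaf) (numDeg≡count 1)) (count-complement isLeaf))))

    evenS : parity s ≡ 0ℙ
    evenS = 2∣⇒even s 2∣N∸r

    leaf-deg : ∀ {v} → nonLeaf v ≡ false → d v ≡ 1
    leaf-deg q = does-≟ (trans (sym (not-involutive _)) (cong not q))

    nonLeaf-intro : ∀ {v} → d v ≢ 1 → nonLeaf v ≡ true
    nonLeaf-intro ne = not-false (hasDeg-false ne)

    nonLeaf-deg : ∀ {v} → nonLeaf v ≡ true → d v ≢ 1
    nonLeaf-deg q e = true≢false (trans (sym (hasDeg-true e)) (not-true q))

    even-∸2≢1 : ∀ t → parity t ≡ 0ℙ → t ∸ 2 ≢ 1
    even-∸2≢1 (suc (suc (suc zero))) () refl

    K : Fin N → Bool
    K v = nonLeaf v ∧ not (eqb v y)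

    x-nonLeaf : nonLeaf x ≡ true
    x-nonLeaf = nonLeaf-intro (λ e → N∸2≢1 (trans (sym dx) e))

    y-nonLeaf : nonLeaf y ≡ true
    y-nonLeaf = nonLeaf-intro (λ e → even-∸2≢1 s evenS (trans (sym dy) e))

    x∈K : K x ≡ true
    x∈K = ∧-intro x-nonLeaf (not-false (eqb-≢ x≢y))

    y∉K : K y ≡ false
    y∉K = trans (cong (λ t → nonLeaf y ∧ not t) (eqb-refl y)) (∧-zeroʳ (nonLeaf y))

    x-sees-all-but-y : ∀ u → u ≢ x → u ≢ y → Adj G x u
    x-sees-all-but-y u ux uy = nbhd-saturated x (λ w → not (eqb w x) ∧ not (eqb w y)) nbhd⊆
      (≤-reflexive (trans (cong (_∸ 2) (count-allBut2 x y x≢y)) (sym dx))) u (∧-intro (not-false (eqb-≢ ux)) (not-false (eqb-≢ uy)))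
      where nbhd⊆ : ∀ w → Adj G x w → not (eqb w x) ∧ not (eqb w y) ≡ true
            nbhd⊆ w xw = ∧-intro (not-false (eqb-≢ (λ e → Adj⇒≢ xw (sym e))))
                                 (not-false (eqb-≢ {i = w} {j = y} (λ { refl → x≁y xw })))

    leaf≢x,y : ∀ {q} → nonLeaf q ≡ false → q ≢ x × q ≢ y
    leaf≢x,y nq = (λ { refl → true≢false (trans (sym x-nonLeaf) nq) }) , (λ { refl → true≢false (trans (sym y-nonLeaf) nq) })

    leaf-at-x : ∀ q → nonLeaf q ≡ false → Adj G q x × (∀ b → Adj G q b → b ≡ x)
    leaf-at-x q nq = q~x , λ b qb → deg1-neighbour q b x (leaf-deg nq) qb q~x
      where q~x = Adj-sym (x-sees-all-but-y q (proj₁ (leaf≢x,y nq)) (proj₂ (leaf≢x,y nq)))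

    pendant : ∀ q → K q ≡ false → q ≢ y → Adj G q x × (∀ b → Adj G q b → b ≡ x)
    pendant q kq qy = leaf-at-x q (isLeaf' (nonLeaf q) refl)
      where isLeaf' : ∀ b → nonLeaf q ≡ b → nonLeaf q ≡ false
            isLeaf' false e = e
            isLeaf' true e = ⊥-elim (true≢false (trans (sym (∧-intro e (not-false (eqb-≢ qy)))) kq))

    nbhd-nonLeaf : ∀ u w → Adj G u w → u ≢ x → nonLeaf w ≡ true
    nbhd-nonLeaf u w uw ux with nonLeaf w in nw
    ... | true = refl
    ... | false = ⊥-elim (ux (proj₂ (leaf-at-x w nw) u (Adj-sym uw)))

    K+1≡s : suc (count K) ≡ s
    K+1≡s = trans (sym (count-remove nonLeaf y y-nonLeaf)) nonLeaves≡s

    y-sees-K : ∀ v → K v ≡ true → v ≢ x → Adj G y v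
    y-sees-K v kv vx = nbhd-saturated y (λ w → K w ∧ not (eqb w x)) nbhd⊆
      (≤-reflexive (sym (trans dy (cong (_∸ 2) (trans (sym K+1≡s) (cong suc (count-remove K x x∈K)))))))
      v (∧-intro kv (not-false (eqb-≢ vx)))
      where nbhd⊆ : ∀ w → Adj G y w → K w ∧ not (eqb w x) ≡ true
            nbhd⊆ w yw = ∧-intro (∧-intro (nbhd-nonLeaf y w yw (λ e → x≢y (sym e))) (not-false (eqb-≢ (λ e → Adj⇒≢ yw (sym e)))))
                                 (not-false (eqb-≢ {i = w} {j = x} (λ { refl → x≁y (Adj-sym yw) })))

    clique : GraphBasics.Clique G K
    clique u v uv ku kv with u ≟F x | v ≟F x
    ... | yes refl | _ = x-sees-all-but-y v (λ e → uv (sym e)) (eqb-false (not-true (∧-true₂ {nonLeaf v} kv)))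
    ... | no _ | yes refl = Adj-sym (x-sees-all-but-y u uv (eqb-false (not-true (∧-true₂ {nonLeaf u} ku))))
    ... | no ux | no vx = nbhd-saturated u (λ w → nonLeaf w ∧ not (eqb w u)) nbhd⊆ size v
                            (∧-intro (∧-true₁ kv) (not-false (eqb-≢ (λ e → uv (sym e)))))
      where
      nbhd⊆ : ∀ w → Adj G u w → nonLeaf w ∧ not (eqb w u) ≡ true
      nbhd⊆ w uw = ∧-intro (nbhd-nonLeaf u w uw ux) (not-false (eqb-≢ (λ e → Adj⇒≢ uw (sym e))))
      u-deg : d u ≡ s ∸ 1
      u-deg with twoDegrees u ux (eqb-false (not-true (∧-true₂ {nonLeaf u} ku)))
      ... | inj₁ e = ⊥-elim (nonLeaf-deg (∧-true₁ ku) e)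
      ... | inj₂ e = e
      size : count (λ w → nonLeaf w ∧ not (eqb w u)) ≤ d u
      size = ≤-reflexive (trans (cong pred (trans (sym (count-remove nonLeaf u (∧-true₁ ku))) nonLeaves≡s)) (sym u-deg))

    oddK : parity (count K) ≡ 1ℙ
    oddK = trans (sym (ℙ.⁻¹-involutive _)) (cong _⁻¹ (trans (sym (parity-suc (count K))) (trans (cong parity K+1≡s) evenS)))
      where import Data.Parity.Properties as ℙ

    pendants≥2 : 2 ≤ count (λ v → not (K v) ∧ not (eqb v y))
    pendants≥2 = subst (2 ≤_) (trans (numDeg≡count 1) (count-ext leaf⇔)) r≥2
      where leaf⇔ : ∀ v → isLeaf v ≡ not (K v) ∧ not (eqb v y)
            leaf⇔ v with v ≟F y
            ... | yes refl = trans (not-true y-nonLeaf) (sym (∧-zeroʳ _))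
            ... | no _ = sym (trans (∧-identityʳ (not (nonLeaf v ∧ true)))
                              (trans (cong not (∧-identityʳ (nonLeaf v))) (not-involutive (isLeaf v))))

    -- y is not isolated; its neighbour lies in K ∖ {x}.
    K-nontrivial : Σ (Fin N) λ v → K v ≡ true × v ≢ x
    K-nontrivial with count-witness (adj y) (λ e → noIsolated y (trans (deg≡count y) e))
    ... | b , yb = b , ∧-intro (nbhd-nonLeaf y b yb (λ e → x≢y (sym e))) (not-false (eqb-≢ (λ e → Adj⇒≢ yb (sym e)))) ,
                   (λ { refl → x≁y (Adj-sym yb) })

    shape : HubClique
    shape = hubClique K x y x∈K y∉K (λ q → x≁y (Adj-sym q)) clique y-sees-K pendant oddK pendants≥2 K-nontrivial

  hubCliqueDegrees⇒shape : NoIsolated G → HubCliqueDegrees → HubClique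
  hubCliqueDegrees⇒shape noIsolated (_ , r≥2 , 2∣N∸r , x , y , x≢y , x≁y , dx , dy , twoDegrees) =
    FromHubCliqueDegrees.shape noIsolated r≥2 2∣N∸r x y x≢y x≁y dx dy twoDegrees

  shape⇒conditions : Shape → Conditions
  shape⇒conditions (inj₁ complete) = inj₁ (complete⇒allUniversal complete)
  shape⇒conditions (inj₂ (inj₁ s)) = inj₂ (inj₁ (star⇒starDegrees s))
  shape⇒conditions (inj₂ (inj₂ (inj₁ P))) = inj₂ (inj₂ (inj₁ (FromPendantClique.degrees P)))
  shape⇒conditions (inj₂ (inj₂ (inj₂ (inj₁ H)))) = inj₂ (inj₂ (inj₂ (inj₁ (FromHubClique.degrees H))))
  shape⇒conditions (inj₂ (inj₂ (inj₂ (inj₂ Q)))) = inj₂ (inj₂ (inj₂ (inj₂ (FromCliquePlusPair.degrees Q))))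

  conditions⇒shape : NoIsolated G → Conditions → Shape
  conditions⇒shape _ (inj₁ c) = inj₁ (allUniversal⇒complete c)
  conditions⇒shape _ (inj₂ (inj₁ c)) = inj₂ (inj₁ (starDegrees⇒star c))
  conditions⇒shape _ (inj₂ (inj₂ (inj₁ c))) = inj₂ (inj₂ (inj₁ (pendantCliqueDegrees⇒shape c)))
  conditions⇒shape noIsolated (inj₂ (inj₂ (inj₂ (inj₁ c)))) = inj₂ (inj₂ (inj₂ (inj₁ (hubCliqueDegrees⇒shape noIsolated c))))
  conditions⇒shape _ (inj₂ (inj₂ (inj₂ (inj₂ c)))) with pairDegrees⇒shape c
  ... | inj₁ Q = inj₂ (inj₂ (inj₂ (inj₂ Q)))
  ... | inj₂ complete = inj₁ complete

module RecogniseShapes {n : ℕ} (G : Graph n) where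

  open import Data.Nat
  open import Data.Nat.Properties
  open import Data.Bool using (Bool; true; false; _∧_; _∨_; not)
  open import Data.Bool.Properties using (∨-zeroʳ)
  open import Data.Fin.Properties using () renaming (_≟_ to _≟F_)
  open import Data.Parity.Base using (_⁻¹)
  open import Data.Product
  open import Data.Sum
  open import Data.Empty
  open import Relation.Nullary
  open import Relation.Binary.PropositionalEquality
  open import Data.Bool.Properties using (∧-zeroʳ)
  open Graph G using (adj)
  open Counting
  open GraphBasics G
  open Shapes G

  not-false⁻¹ : ∀ {b} → not b ≡ false → b ≡ true
  not-false⁻¹ {true} _ = refl

  -- An even clique C whose outside vertices are all pendants at z ∈ C: with
  -- no pendant G is complete, with one it is a clique plus a pair, with two
  -- or more it is a star (|C| = 2) or a pendant clique (|C| ≥ 4).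
  module PendantsAt (C : Fin n → Bool) (z : Fin n) (z∈C : C z ≡ true) (clique : Clique C)
    (pendant : ∀ a → C a ≡ false → Adj G a z × (∀ b → Adj G a b → b ≡ z)) (evenC : parity (count C) ≡ 0ℙ) where

    -- A single pendant q: C is a clique, q and a clique vertex w ≠ z form
    -- the non-adjacent pair, and n = |C| + 1 is odd.
    one-pendant-shape : count (λ v → not (C v)) ≡ 1 → Shape
    one-pendant-shape outside =
      inj₂ (inj₂ (inj₂ (inj₂ (cliquePlusPair oddN q w q≢w q≁w (λ u uq uw → inj₂ (clique u w uw (inC u uq) w∈C))
                                (λ u v uv uq _ vq _ → clique u v uv (inC u uq) (inC v vq))))))
      where
      C+1≡n : count C + 1 ≡ n
      C+1≡n = trans (cong (count C +_) (sym outside)) (count-complement C)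
      oddN : parity n ≡ 1ℙ
      oddN = trans (sym (cong parity C+1≡n)) (trans (parity-+1 (count C)) (cong _⁻¹ evenC))
      q0 : Σ (Fin n) λ q → not (C q) ≡ true
      q0 = count-witness (λ v → not (C v)) (λ e → 1≢0 (trans (sym outside) e))
        where 1≢0 : 1 ≢ 0
              1≢0 ()
      q : Fin n
      q = proj₁ q0
      q∉C : C q ≡ false
      q∉C = not-true (proj₂ q0)
      inC : ∀ u → u ≢ q → C u ≡ true
      inC u uq with C u in cu
      ... | true = refl
      ... | false = ⊥-elim (uq (count-one (λ v → not (C v)) outside u q (not-false cu) (proj₂ q0)))
      -- C has at least two vertices, since |C| is even and |C| = n - 1 ≥ 1.
      w0 : Σ (Fin n) λ w → C w ∧ not (eqb w z) ≡ true
      w0 = count-witness (λ v → C v ∧ not (eqb v z)) (λ e → C≢1 (trans (count-remove C z z∈C) (cong suc e)))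
        where C≢1 : count C ≢ 1
              C≢1 e = 0ℙ≢1ℙ (trans (sym evenC) (cong parity e))
      w : Fin n
      w = proj₁ w0
      w∈C : C w ≡ true
      w∈C = ∧-true₁ (proj₂ w0)
      w≢z : w ≢ z
      w≢z = eqb-false (not-true (∧-true₂ {C w} (proj₂ w0)))
      q≢w : q ≢ w
      q≢w e = true≢false (trans (sym w∈C) (trans (cong C (sym e)) q∉C))
      q≁w : ¬ Adj G q w
      q≁w qw = w≢z (proj₂ (pendant q q∉C) w qw)

    star-shape : count C ≡ 2 → Shape
    star-shape C≡2 = inj₂ (inj₁ (star z centre leaves))
      where
      centre : ∀ u → u ≢ z → Adj G z u
      centre u uz with C u in cu
      ... | true = clique z u (λ e → uz (sym e)) z∈C cu
      ... | false = Adj-sym (proj₁ (pendant u cu))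
      leaves : ∀ u v → u ≢ z → v ≢ z → ¬ Adj G u v
      leaves u v uz vz uv with C u in cu | C v in cv
      ... | false | _ = vz (proj₂ (pendant u cu) v uv)
      ... | true | false = uz (proj₂ (pendant v cv) u (Adj-sym uv))
      ... | true | true with subst (2 ≤_) (cong pred (trans (sym (count-remove C z z∈C)) C≡2))
               (count-two (λ j → C j ∧ not (eqb j z)) u v (Adj⇒≢ uv)
                          (∧-intro cu (not-false (eqb-≢ uz))) (∧-intro cv (not-false (eqb-≢ vz))))
      ... | s≤s ()

    shape : Shape
    shape with count (λ v → not (C v)) in outside
    ... | zero = inj₁ (λ u v uv → clique u v uv (inC u) (inC v))
      where inC : ∀ u → C u ≡ true
            inC u = not-false⁻¹ (count-zero (λ v → not (C v)) outside u)
    ... | suc zero = one-pendant-shape outside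
    ... | suc (suc _) with count C ≟ 2
    ... | yes C≡2 = star-shape C≡2
    ... | no C≢2 = inj₂ (inj₂ (inj₁ (pendantClique C z z∈C clique pendant evenC
                     (even-≥4 (count C) evenC (count-pos C z z∈C) C≢2) (subst (2 ≤_) (sym outside) (s≤s (s≤s z≤n))))))

  pendant-shape : (C : Fin n → Bool) (z : Fin n) → C z ≡ true → Clique C →
    (∀ a → C a ≡ false → Adj G a z × (∀ b → Adj G a b → b ≡ z)) → parity (count C) ≡ 0ℙ → Shape
  pendant-shape = PendantsAt.shape

  -- An odd clique K with hub c, an outside vertex a seeing K ∖ {c} but not c,
  -- and all other outside vertices (at least one, q0) pendants at c: with one
  -- pendant G is a clique plus a pair, with more it is a hub clique.
  hub-shape : (K : Fin n → Bool) (c a : Fin n) → K c ≡ true → K a ≡ false → ¬ Adj G a c → Clique K →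
    (∀ v → K v ≡ true → v ≢ c → Adj G a v) →
    (∀ q → K q ≡ false → q ≢ a → Adj G q c × (∀ b → Adj G q b → b ≡ c)) →
    parity (count K) ≡ 1ℙ → (Σ (Fin n) λ v → K v ≡ true × v ≢ c) →
    (q0 : Fin n) → not (K q0) ∧ not (eqb q0 a) ≡ true → Shape
  hub-shape K c a c∈K a∉K a≁c clique a~K pendant oddK K-nontrivial q0 q0-pendant
    with count (λ v → not (K v) ∧ not (eqb v a)) in pendants
  ... | zero = ⊥-elim (true≢false (trans (sym q0-pendant) (count-zero (λ v → not (K v) ∧ not (eqb v a)) pendants q0)))
  ... | suc (suc _) = inj₂ (inj₂ (inj₂ (inj₁ (hubClique K c a c∈K a∉K a≁c clique a~K pendant oddK
                        (subst (2 ≤_) (sym pendants) (s≤s (s≤s z≤n))) K-nontrivial))))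
  ... | suc zero = inj₂ (inj₂ (inj₂ (inj₂ (cliquePlusPair oddN q0 a q0≢a q0≁a dominated
                     (λ u v uv uq ua vq va → clique u v uv (inK u uq ua) (inK v vq va))))))
    where
    q0∉K : K q0 ≡ false
    q0∉K = not-true (∧-true₁ q0-pendant)
    q0≢a : q0 ≢ a
    q0≢a = eqb-false (not-true (∧-true₂ {not (K q0)} q0-pendant))
    K+2≡n : count K + 2 ≡ n
    K+2≡n = trans (cong (count K +_) (cong suc (sym pendants)))
      (trans (cong (count K +_) (sym (count-remove (λ v → not (K v)) a (not-false a∉K)))) (count-complement K))
    oddN : parity n ≡ 1ℙ
    oddN = trans (sym (cong parity K+2≡n)) (trans (parity-+2 (count K)) oddK)
    inK : ∀ w → w ≢ q0 → w ≢ a → K w ≡ true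
    inK w wq wa with K w in kw
    ... | true = refl
    ... | false = ⊥-elim (wq (count-one (λ v → not (K v) ∧ not (eqb v a)) pendants w q0
                                (∧-intro (cong not kw) (not-false (eqb-≢ wa))) q0-pendant))
    q0≁a : ¬ Adj G q0 a
    q0≁a qa = true≢false (trans (sym c∈K) (trans (cong K (sym (proj₂ (pendant q0 q0∉K q0≢a) a qa))) a∉K))
    dominated : ∀ w → w ≢ q0 → w ≢ a → Adj G w q0 ⊎ Adj G w a
    dominated w wq wa with w ≟F c
    ... | yes refl = inj₁ (Adj-sym (proj₁ (pendant q0 q0∉K q0≢a)))
    ... | no wc = inj₂ (Adj-sym (a~K w (inK w wq wa) wc))

  module FromEquimatchableSplit (eqm : Equimatchable G) (C : Fin n → Bool) (clique : Clique C)
                                (independent : IndependentRest C) (noIsolated : NoIsolated G) where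
    open ForbiddenConfigurations G eqm C clique independent
      using (CrossEdge; in≢out; no-two-cross-edges; no-cross-edge-if-inner; no-three-cross-edges)
    open Degrees G using (deg≡count)

    in-clique : ∀ a b → C a ≡ false → Adj G a b → C b ≡ true
    in-clique a b ca ab with C b in cb
    ... | true = refl
    ... | false = ⊥-elim (independent a b ca cb ab)

    neighbour : ∀ v → Σ (Fin n) λ b → Adj G v b
    neighbour v = count-witness (adj v) (λ e → noIsolated v (trans (deg≡count v) e))

    cross : ∀ {b a} → C a ≡ false → Adj G a b → CrossEdge b a
    cross {b} {a} ca ab = in-clique a b ca ab , ca , Adj-sym ab

    ≢sym : ∀ {A : Set} {x y : A} → x ≢ y → y ≢ x
    ≢sym ne e = ne (sym e)

    -- |C| odd, z ∈ C, a ∉ C adjacent to z: if all outside vertices except a are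
    -- pendants at z and a sees all of C ∖ {z}, then C ∪ {a} is an even clique
    -- with pendants at z.
    joined-pendant-shape : (z a : Fin n) → C z ≡ true → C a ≡ false → Adj G a z →
      (∀ q → C q ≡ false → q ≢ a → ∀ b → Adj G q b → b ≡ z) →
      (∀ v → C v ≡ true → v ≢ z → Adj G v a) → parity (count C) ≡ 1ℙ → Shape
    joined-pendant-shape z a z∈C a∉C az onlyZ a~C oddC = pendant-shape C' z (cong (_∨ eqb z a) z∈C) clique' pendant evenC'
      where
      C' : Fin n → Bool
      C' v = C v ∨ eqb v a
      a~C' : ∀ u → C u ≡ true → Adj G u a
      a~C' u cu with u ≟F z
      ... | yes refl = Adj-sym az
      ... | no uz = a~C u cu uz
      clique' : Clique C'
      clique' u v uv cu cv with C u in eu | C v in ev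
      ... | true | true = clique u v uv eu ev
      ... | true | false with eqb-≡ {i = v} {j = a} cv
      ... | refl = a~C' u eu
      clique' u v uv cu cv | false | true with eqb-≡ {i = u} {j = a} cu
      ... | refl = Adj-sym (a~C' v ev)
      clique' u v uv cu cv | false | false = ⊥-elim (uv (trans (eqb-≡ {i = u} {j = a} cu) (sym (eqb-≡ {i = v} {j = a} cv))))
      pendant : ∀ q → C' q ≡ false → Adj G q z × (∀ b → Adj G q b → b ≡ z)
      pendant q cq = subst (Adj G q) (onlyZ q q∉C q≢a _ (proj₂ (neighbour q))) (proj₂ (neighbour q)) , onlyZ q q∉C q≢a
        where
        q∉C : C q ≡ false
        q∉C = ∨-false₁ (C q) cq
          where ∨-false₁ : ∀ x {y} → x ∨ y ≡ false → x ≡ false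
                ∨-false₁ false _ = refl
        q≢a : q ≢ a
        q≢a refl = true≢false (trans (sym (trans (cong (C q ∨_) (eqb-refl q)) (∨-zeroʳ (C q)))) cq)
      evenC' : parity (count C') ≡ 0ℙ
      evenC' = trans (cong parity C'≡C+1) (trans (parity-+1 (count C)) (cong _⁻¹ oddC))
        where
        disjoint : ∀ v → C v ∧ eqb v a ≡ false
        disjoint v with v ≟F a
        ... | yes refl = cong (_∧ true) a∉C
        ... | no _ = ∧-zeroʳ (C v)
        C'≡C+1 : count C' ≡ count C + 1
        C'≡C+1 = trans (sym (+-identityʳ (count C'))) (trans (cong (count C' +_) (sym (count-none _ disjoint)))
                   (trans (count-∨ C (λ v → eqb v a)) (cong (count C +_) (count-eqb a))))

    -- Then G has a shape: a pendant
    -- clique on C ∪ {a} if a ~ z, a hub clique with hub z otherwise.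
    covered-shape : (z a : Fin n) → C z ≡ true → C a ≡ false →
      (∀ q → C q ≡ false → q ≢ a → ∀ b → Adj G q b → b ≡ z) →
      (∀ v → C v ≡ true → v ≢ z → Adj G v a) → parity (count C) ≡ 1ℙ →
      (Σ (Fin n) λ v → C v ≡ true × v ≢ z) → (q0 : Fin n) → not (C q0) ∧ not (eqb q0 a) ≡ true → Shape
    covered-shape z a z∈C a∉C onlyZ a~C oddC C-nontrivial q0 q0-pendant with adj a z in eaz
    ... | true = joined-pendant-shape z a z∈C a∉C eaz onlyZ a~C oddC
    ... | false = hub-shape C z a z∈C a∉C (false⇒¬Adj eaz) clique (λ v cv vz → Adj-sym (a~C v cv vz))
                    (λ q cq qa → subst (Adj G q) (onlyZ q cq qa _ (proj₂ (neighbour q))) (proj₂ (neighbour q)) , onlyZ q cq qa)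
                    oddC C-nontrivial q0 q0-pendant

    isCross : Fin n → Fin n → Bool
    isCross b a = C b ∧ not (C a) ∧ adj b a

    isCross-sound : ∀ {b a} → isCross b a ≡ true → CrossEdge b a
    isCross-sound {b} {a} p = ∧-true₁ p , not-true (∧-true₁ (∧-true₂ {C b} p)) , ∧-true₂ {not (C a)} (∧-true₂ {C b} p)

    isCross-complete : ∀ {b a} → CrossEdge b a → isCross b a ≡ true
    isCross-complete (cb , ia , ba) = ∧-intro cb (∧-intro (not-false ia) ba)

    module OddClique (oddC : parity (count C) ≡ 1ℙ)
                     (outsideNeighbour : ∀ w → C w ≡ true → Σ (Fin n) λ x → C x ≡ false × Adj G w x) where

      no-three : ∀ {b1 a1 b2 a2 b3 a3} → CrossEdge b1 a1 → CrossEdge b2 a2 → CrossEdge b3 a3 →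
        b1 ≢ b2 → b1 ≢ b3 → b2 ≢ b3 → a1 ≢ a2 → a1 ≢ a3 → a2 ≢ a3 → ⊥
      no-three = no-three-cross-edges oddC

      two-outside-shape : ∀ a0 a1 → C a0 ≡ false → C a1 ≡ false → a0 ≢ a1 →
        (∀ v → C v ≡ false → v ≡ a0 ⊎ v ≡ a1) → Shape
      two-outside-shape a0 a1 ia0 ia1 a0≢a1 onlyA0A1 =
        inj₂ (inj₂ (inj₂ (inj₂ (cliquePlusPair oddN a0 a1 a0≢a1 (independent a0 a1 ia0 ia1) dominated
          (λ u v uv u0 u1 v0 v1 → clique u v uv (inC u u0 u1) (inC v v0 v1))))))
        where
        inC : ∀ w → w ≢ a0 → w ≢ a1 → C w ≡ true
        inC w w0 w1 with C w in cw
        ... | true = refl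
        ... | false with onlyA0A1 w cw
        ... | inj₁ e = ⊥-elim (w0 e)
        ... | inj₂ e = ⊥-elim (w1 e)
        outside≡2 : count (λ v → not (C v)) ≡ 2
        outside≡2 = ≤-antisym (≤-trans (count-mono (λ v → not (C v)) (λ v → eqb v a0 ∨ eqb v a1) a0∨a1)
                                 (≤-trans (count-∨-≤ (λ v → eqb v a0) (λ v → eqb v a1))
                                    (≤-reflexive (cong₂ _+_ (count-eqb a0) (count-eqb a1)))))
                               (count-two (λ v → not (C v)) a0 a1 a0≢a1 (not-false ia0) (not-false ia1))
          where a0∨a1 : ∀ v → not (C v) ≡ true → eqb v a0 ∨ eqb v a1 ≡ true
                a0∨a1 v q with onlyA0A1 v (not-true q)
                ... | inj₁ refl = cong (_∨ eqb v a1) (eqb-refl v)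
                ... | inj₂ refl = trans (cong (eqb v a0 ∨_) (eqb-refl v)) (∨-zeroʳ _)
        oddN : parity n ≡ 1ℙ
        oddN = trans (cong parity (sym (trans (cong (count C +_) (sym outside≡2)) (count-complement C))))
                     (trans (parity-+2 (count C)) oddC)
        dominated : ∀ w → w ≢ a0 → w ≢ a1 → Adj G w a0 ⊎ Adj G w a1
        dominated w w0 w1 with outsideNeighbour w (inC w w0 w1)
        ... | x , ix , wx with onlyA0A1 x ix
        ... | inj₁ refl = inj₁ wx
        ... | inj₂ refl = inj₂ wx

      -- Every cross edge meets B0 or A1 (otherwise three disjoint cross edges
      -- appear, possibly using a third clique vertex B2, which must see A1),
      -- so all outside vertices but A1 are pendants at B0 and A1 sees C ∖ {B0}.
      module TwoCrossEdges {B0 A0 B1 A1 : Fin n} (A2 : Fin n) (e0 : CrossEdge B0 A0) (e1 : CrossEdge B1 A1)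
          (B0≢B1 : B0 ≢ B1) (A0≢A1 : A0 ≢ A1) (iA2 : C A2 ≡ false) (A2≢A0 : A2 ≢ A0) (A2≢A1 : A2 ≢ A1)
          (B0A2 : Adj G B0 A2) where
        cB0 : C B0 ≡ true
        cB0 = proj₁ e0
        iA0 : C A0 ≡ false
        iA0 = proj₁ (proj₂ e0)
        cB1 : C B1 ≡ true
        cB1 = proj₁ e1
        iA1 : C A1 ≡ false
        iA1 = proj₁ (proj₂ e1)
        e2 : CrossEdge B0 A2
        e2 = cB0 , iA2 , B0A2
        third : Σ (Fin n) λ v → (C v ∧ not (eqb v B0)) ∧ not (eqb v B1) ≡ true
        third = count-witness _ (λ e → 3≰2 (subst (3 ≤_) (trans C≡ (cong (suc ∘′ suc) e)) C≥3))
          where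
          open import Function using (_∘′_)
          3≰2 : ¬ (3 ≤ 2)
          3≰2 (s≤s (s≤s ()))
          C≥3 : 3 ≤ count C
          C≥3 = odd-≥3 (count C) oddC (count-two C B0 B1 B0≢B1 cB0 cB1)
          C≡ : count C ≡ suc (suc (count (λ v → (C v ∧ not (eqb v B0)) ∧ not (eqb v B1))))
          C≡ = trans (count-remove C B0 cB0) (cong suc (count-remove (λ v → C v ∧ not (eqb v B0)) B1
                 (∧-intro cB1 (not-false (eqb-≢ (≢sym B0≢B1))))))
        B2 : Fin n
        B2 = proj₁ third
        cB2 : C B2 ≡ true
        cB2 = ∧-true₁ (∧-true₁ (proj₂ third))
        B2≢B0 : B2 ≢ B0
        B2≢B0 = eqb-false (not-true (∧-true₂ {C B2} (∧-true₁ (proj₂ third))))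
        B2≢B1 : B2 ≢ B1
        B2≢B1 = eqb-false (not-true (∧-true₂ {C B2 ∧ not (eqb B2 B0)} (proj₂ third)))
        B2A1 : Adj G B2 A1
        B2A1 with outsideNeighbour B2 cB2
        ... | x , ix , B2x with x ≟F A1
        ... | yes refl = B2x
        ... | no x≢A1 with x ≟F A0
        ... | yes refl = ⊥-elim (no-three e2 (cB2 , iA0 , B2x) e1 (≢sym B2≢B0) B0≢B1 B2≢B1 A2≢A0 A2≢A1 A0≢A1)
        ... | no x≢A0 = ⊥-elim (no-three e0 e1 (cB2 , ix , B2x) B0≢B1 (≢sym B2≢B0) (≢sym B2≢B1) A0≢A1 (≢sym x≢A0) (≢sym x≢A1))
        e3 : CrossEdge B2 A1
        e3 = cB2 , iA1 , B2A1
        meets : ∀ b a → CrossEdge b a → b ≡ B0 ⊎ a ≡ A1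
        meets b a eba with b ≟F B0 | a ≟F A1
        ... | yes e | _ = inj₁ e
        ... | no _ | yes e = inj₂ e
        ... | no b≢B0 | no a≢A1 with a ≟F A0 | b ≟F B1
        ... | yes refl | yes refl = ⊥-elim (no-three eba e2 e3 (≢sym B0≢B1) (≢sym B2≢B1) (≢sym B2≢B0) (≢sym A2≢A0) A0≢A1 A2≢A1)
        ... | yes refl | no b≢B1 = ⊥-elim (no-three eba e2 e1 b≢B0 b≢B1 B0≢B1 (≢sym A2≢A0) A0≢A1 A2≢A1)
        ... | no a≢A0 | yes refl = ⊥-elim (no-three eba e0 e3 (≢sym B0≢B1) (≢sym B2≢B1) (≢sym B2≢B0) a≢A0 a≢A1 A0≢A1)
        ... | no a≢A0 | no b≢B1 = ⊥-elim (no-three eba e0 e1 b≢B0 b≢B1 B0≢B1 a≢A0 a≢A1 A0≢A1)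
        pendantAtB0 : ∀ q → C q ≡ false → q ≢ A1 → ∀ b → Adj G q b → b ≡ B0
        pendantAtB0 q iq q≢A1 b qb with meets b q (cross iq qb)
        ... | inj₁ e = e
        ... | inj₂ e = ⊥-elim (q≢A1 e)
        seesA1 : ∀ v → C v ≡ true → v ≢ B0 → Adj G v A1
        seesA1 v cv v≢B0 with outsideNeighbour v cv
        ... | x , ix , vx with meets v x (cv , ix , vx)
        ... | inj₁ e = ⊥-elim (v≢B0 e)
        ... | inj₂ refl = vx

        shape : Shape
        shape = covered-shape B0 A1 cB0 iA1 pendantAtB0 seesA1 oddC (B1 , cB1 , ≢sym B0≢B1) A0
                              (∧-intro (not-false iA0) (not-false (eqb-≢ A0≢A1)))

      two-cross-edges-shape : ∀ {B0 A0 B1 A1} A2 → CrossEdge B0 A0 → CrossEdge B1 A1 → B0 ≢ B1 → A0 ≢ A1 →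
        C A2 ≡ false → A2 ≢ A0 → A2 ≢ A1 → Adj G B0 A2 → Shape
      two-cross-edges-shape = TwoCrossEdges.shape

      -- All cross edges meet b0 or a0: then C ∪ {a0} is an even clique with
      -- pendants at b0.
      meeting-shape : ∀ {b0 a0} → CrossEdge b0 a0 → (∀ {b a} → CrossEdge b a → b ≡ b0 ⊎ a ≡ a0) → Shape
      meeting-shape {b0} {a0} (cb0 , ia0 , b0a0) meets =
        joined-pendant-shape b0 a0 cb0 ia0 (Adj-sym b0a0) pendantAtB0 seesA0 oddC
        where
        pendantAtB0 : ∀ q → C q ≡ false → q ≢ a0 → ∀ b → Adj G q b → b ≡ b0
        pendantAtB0 q iq q≢a0 b qb with meets (cross iq qb)
        ... | inj₁ e = e
        ... | inj₂ e = ⊥-elim (q≢a0 e)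
        seesA0 : ∀ v → C v ≡ true → v ≢ b0 → Adj G v a0
        seesA0 v cv v≢b0 with outsideNeighbour v cv
        ... | x , ix , vx with meets (cv , ix , vx)
        ... | inj₁ e = ⊥-elim (v≢b0 e)
        ... | inj₂ refl = vx

      -- Two disjoint cross edges b0 a0 and b1 a1: either the outside is
      -- {a0, a1}, or a third outside vertex a2 has its neighbour among b0, b1
      -- (three disjoint cross edges being excluded) and two-cross-edges-shape applies.
      disjoint-pair-shape : ∀ {b0 a0 b1 a1} → CrossEdge b0 a0 → CrossEdge b1 a1 → b1 ≢ b0 → a1 ≢ a0 → Shape
      disjoint-pair-shape {b0} {a0} {b1} {a1} e0 e1 b1≢b0 a1≢a0
        with search (λ v → not (C v) ∧ not (eqb v a0) ∧ not (eqb v a1))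
      ... | inj₂ none = two-outside-shape a0 a1 (proj₁ (proj₂ e0)) (proj₁ (proj₂ e1)) (≢sym a1≢a0) onlyA0A1
        where
        onlyA0A1 : ∀ v → C v ≡ false → v ≡ a0 ⊎ v ≡ a1
        onlyA0A1 v iv with v ≟F a0 | v ≟F a1
        ... | yes e | _ = inj₁ e
        ... | no _ | yes e = inj₂ e
        ... | no n0 | no n1 = ⊥-elim (true≢false (trans (sym (∧-intro (not-false iv)
                                (∧-intro (not-false (eqb-≢ n0)) (not-false (eqb-≢ n1))))) (none v)))
      ... | inj₁ (a2 , p2) = third-outside a2 (not-true (∧-true₁ p2))
              (eqb-false (not-true (∧-true₁ (∧-true₂ {not (C a2)} p2))))
              (eqb-false (not-true (∧-true₂ {not (eqb a2 a0)} (∧-true₂ {not (C a2)} p2))))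
        where
        third-outside : ∀ a2 → C a2 ≡ false → a2 ≢ a0 → a2 ≢ a1 → Shape
        third-outside a2 ia2 a2≢a0 a2≢a1 with neighbour a2
        ... | c , a2c with c ≟F b0 | c ≟F b1
        ... | yes refl | _ = two-cross-edges-shape a2 e0 e1 (≢sym b1≢b0) (≢sym a1≢a0) ia2 a2≢a0 a2≢a1 (Adj-sym a2c)
        ... | no _ | yes refl = two-cross-edges-shape a2 e1 e0 b1≢b0 a1≢a0 ia2 a2≢a1 a2≢a0 (Adj-sym a2c)
        ... | no c≢b0 | no c≢b1 = ⊥-elim (no-three e0 e1 (cross ia2 a2c) (≢sym b1≢b0) (≢sym c≢b0) (≢sym c≢b1)
                                           (≢sym a1≢a0) (≢sym a2≢a0) (≢sym a2≢a1))

      odd-shape : ∀ {b0 a0} → CrossEdge b0 a0 → Shape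
      odd-shape {b0} {a0} e0 with search2 (λ b a → isCross b a ∧ not (eqb b b0) ∧ not (eqb a a0))
      ... | inj₂ none = meeting-shape e0 meets
        where
        meets : ∀ {b a} → CrossEdge b a → b ≡ b0 ⊎ a ≡ a0
        meets {b} {a} eba with b ≟F b0 | a ≟F a0
        ... | yes e | _ = inj₁ e
        ... | no _ | yes e = inj₂ e
        ... | no b≢b0 | no a≢a0 = ⊥-elim (true≢false (trans (sym (∧-intro (isCross-complete eba)
                                     (∧-intro (not-false (eqb-≢ b≢b0)) (not-false (eqb-≢ a≢a0))))) (none b a)))
      ... | inj₁ (b1 , a1 , p1) = disjoint-pair-shape e0 (isCross-sound (∧-true₁ p1))
            (eqb-false (not-true (∧-true₁ (∧-true₂ {isCross b1 a1} p1))))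
            (eqb-false (not-true (∧-true₂ {not (eqb b1 b0)} (∧-true₂ {isCross b1 a1} p1))))

    -- |C| even and the outside is the single vertex a0: G is complete if a0
    -- sees all of C, and otherwise a clique plus the pair a0, y for a
    -- non-neighbour y of a0.
    one-outside-shape : ∀ a0 → C a0 ≡ false → (∀ v → C v ≡ false → v ≡ a0) → parity (count C) ≡ 0ℙ → Shape
    one-outside-shape a0 ia0 onlyA0 evenC with search (λ v → C v ∧ not (adj a0 v))
    ... | inj₂ none = inj₁ complete
      where
      a0~C : ∀ v → C v ≡ true → Adj G a0 v
      a0~C v cv with adj a0 v in e
      ... | true = refl
      ... | false = ⊥-elim (true≢false (trans (sym (∧-intro cv (not-false e))) (none v)))
      complete : Complete
      complete u v uv with C u in cu | C v in cv
      ... | true | true = clique u v uv cu cv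
      ... | false | true with onlyA0 u cu
      ... | refl = a0~C v cv
      complete u v uv | true | false with onlyA0 v cv
      ... | refl = Adj-sym (a0~C u cu)
      complete u v uv | false | false = ⊥-elim (uv (trans (onlyA0 u cu) (sym (onlyA0 v cv))))
    ... | inj₁ (y , py) = inj₂ (inj₂ (inj₂ (inj₂ (cliquePlusPair oddN a0 y (≢sym (in≢out cy ia0)) a0≁y
                            (λ w wa wy → inj₂ (clique w y wy (inC w wa) cy))
                            (λ u v uv ua uy va vy → clique u v uv (inC u ua) (inC v va))))))
      where
      cy : C y ≡ true
      cy = ∧-true₁ py
      a0≁y : ¬ Adj G a0 y
      a0≁y q = true≢false (trans (sym q) (not-true (∧-true₂ {C y} py)))
      inC : ∀ w → w ≢ a0 → C w ≡ true
      inC w wa with C w in cw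
      ... | true = refl
      ... | false = ⊥-elim (wa (onlyA0 w cw))
      outside≡1 : count (λ v → not (C v)) ≡ 1
      outside≡1 = count-single (λ v → not (C v)) a0 (not-false ia0) (λ j pj → onlyA0 j (not-true pj))
      oddN : parity n ≡ 1ℙ
      oddN = trans (cong parity (sym (trans (cong (count C +_) (sym outside≡1)) (count-complement C))))
                   (trans (parity-+1 (count C)) (cong _⁻¹ evenC))

    -- If every outside vertex only sees b0,
    -- G is built from a clique with pendants at b0.  Otherwise some cross edge
    -- b a has b ≠ b0; two disjoint cross edges being forbidden, a = a0 and a0
    -- is the only outside vertex.
    even-shape : parity (count C) ≡ 0ℙ → ∀ {b0 a0} → CrossEdge b0 a0 → Shape
    even-shape evenC {b0} {a0} e0@(cb0 , ia0 , b0a0) with search2 (λ b a → isCross b a ∧ not (eqb b b0))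
    ... | inj₂ none = pendant-shape C b0 cb0 clique pendant evenC
      where
      onlyB0 : ∀ a → C a ≡ false → ∀ b → Adj G a b → b ≡ b0
      onlyB0 a ia b ab with b ≟F b0
      ... | yes e = e
      ... | no ne = ⊥-elim (true≢false (trans (sym (∧-intro (isCross-complete (cross ia ab)) (not-false (eqb-≢ ne)))) (none b a)))
      pendant : ∀ a → C a ≡ false → Adj G a b0 × (∀ b → Adj G a b → b ≡ b0)
      pendant a ia = subst (Adj G a) (onlyB0 a ia _ (proj₂ (neighbour a))) (proj₂ (neighbour a)) , onlyB0 a ia
    ... | inj₁ (b , a , p) = one-outside-shape a0 ia0 onlyA0 evenC
      where
      e : CrossEdge b a
      e = isCross-sound (∧-true₁ p)
      b≢b0 : b ≢ b0
      b≢b0 = eqb-false (not-true (∧-true₂ {isCross b a} p))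
      a≡a0 : a ≡ a0
      a≡a0 with a ≟F a0
      ... | yes eq = eq
      ... | no ne = ⊥-elim (no-two-cross-edges evenC e0 e (≢sym b≢b0) (≢sym ne))
      e' : CrossEdge b a0
      e' = subst (CrossEdge b) a≡a0 e
      onlyA0 : ∀ v → C v ≡ false → v ≡ a0
      onlyA0 v iv with v ≟F a0
      ... | yes eq = eq
      ... | no ne with neighbour v
      ... | c , vc with c ≟F b0
      ... | yes refl = ⊥-elim (no-two-cross-edges evenC e' (cross iv vc) b≢b0 (≢sym ne))
      ... | no c≢b0 = ⊥-elim (no-two-cross-edges evenC e0 (cross iv vc) (≢sym c≢b0) (≢sym ne))

    -- The classification: G is complete if the outside is empty; otherwise
    -- an outside vertex and its neighbour form a cross edge, and the parity of
    -- |C| selects the case.  For |C| odd, the cross edge rules out clique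
    -- vertices without outside neighbours.
    shape : Shape
    shape with search (λ v → not (C v))
    ... | inj₂ allIn = inj₁ (λ u v uv → clique u v uv (not-false⁻¹ (allIn u)) (not-false⁻¹ (allIn v)))
    ... | inj₁ (a0 , p0) with neighbour a0 | parity (count C) in pC
    ... | b0 , a0b0 | 0ℙ = even-shape pC (cross (not-true p0) a0b0)
    ... | b0 , a0b0 | 1ℙ = OddClique.odd-shape pC outsideNeighbour (cross (not-true p0) a0b0)
      where
      outsideNeighbour : ∀ w → C w ≡ true → Σ (Fin n) λ x → C x ≡ false × Adj G w x
      outsideNeighbour w cw with search (λ x → not (C x) ∧ adj w x)
      ... | inj₁ (x , px) = x , not-true (∧-true₁ px) , ∧-true₂ {not (C x)} px
      ... | inj₂ none = ⊥-elim (no-cross-edge-if-inner pC w cw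
                          (λ x ix wx → true≢false (trans (sym (∧-intro (not-false ix) wx)) (none x)))
                          (cross (not-true p0) a0b0))

-- Both directions pass through the five shapes: an equimatchable split graph
-- has a shape, and a shape satisfies the degree conditions; conversely the
-- degree conditions force a shape, and each shape is equimatchable and split.
theorem3p1 : (n : ℕ) → 4 ≤ n → (G : Graph n) → NoIsolated G →
    let r = numDeg G 1
        p = numDeg G (n ∸ 1)
        d = deg G
    in (Equimatchable G × IsSplit G) ⇔
       ( (p ≡ n)
       ⊎ (r ≡ n ∸ 1 × p ≡ 1)
       ⊎ (p ≡ 1 × 2 ≤ r × 2 ∣ (n ∸ r) ×
            (∀ v → d v ≡ 1 ⊎ d v ≡ n ∸ r ∸ 1 ⊎ d v ≡ n ∸ 1))
       ⊎ (p ≡ 0 × 2 ≤ r × 2 ∣ (n ∸ r) ×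
            Σ (Fin n) λ x → Σ (Fin n) λ y → x ≢ y × ¬ Adj G x y ×
              d x ≡ n ∸ 2 × d y ≡ n ∸ r ∸ 2 ×
              (∀ v → v ≢ x → v ≢ y → d v ≡ 1 ⊎ d v ≡ n ∸ r ∸ 1))
       ⊎ (¬ 2 ∣ n ×
            Σ (Fin n) λ x → Σ (Fin n) λ y → x ≢ y ×
              d x + d y ≡ p + n ∸ 2 ×
              (∀ v → v ≢ x → v ≢ y → d v ≡ n ∸ 1 ⊎ d v ≡ n ∸ 2)) )
theorem3p1 (suc (suc (suc (suc m)))) (s≤s (s≤s (s≤s (s≤s z≤n)))) G noIsolated = mk⇔ necessary sufficient
  where
  open DegreeConditions m G using (Conditions; shape⇒conditions; conditions⇒shape)

  necessary : Equimatchable G × IsSplit G → Conditions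
  necessary (eqm , C , clique , independent) =
    shape⇒conditions (RecogniseShapes.FromEquimatchableSplit.shape G eqm C clique independent noIsolated)

  sufficient : Conditions → Equimatchable G × IsSplit G
  sufficient conditions =
    ShapesAreEquimatchableSplit.shape⇒equimatchable-split G (s≤s (s≤s z≤n)) (conditions⇒shape noIsolated conditions)
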